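{- Let $pod_2(n)$ be defined by $\sum_{n\ge 0} pod_2(n)q^n = \frac{\psi(-q^2)}{\psi(-q)} = \frac{f_2^2 f_8}{f_1 f_4^2}$, and let $\tau(n)$ be Ramanujan's tau function. Let $p$ be an odd prime. Then: (i) Suppose $s$ is an integer with $1\le s\le 8p$, $s\equiv 1 \pmod 8$ and $\left(\frac{s}{p}\right) = -1$ (Legendre symbol). Then for all $n\ge 0$, $$pod_2\!\left(pn + \frac{s-1}{8}\right)\equiv 0 \pmod 2.$$ If moreover $\tau(p)\equiv 0 \pmod 2$, then for all $n\ge 0$ and $k\ge 1$, $$pod_2\!\left(p^{2k+1}n + \frac{sp^{2k}-1}{8}\right)\equiv 0 \pmod 2.$$ (ii) Suppose $r$ is an integer with $1\le r\le 8p$, $rp\equiv 1 \pmod 8$ and $\gcd(r,p)=1$. If $\tau(p)\equiv 0\pmod 2$, then for all $n\ge 0$ and $k\ge 1$, $$pod_2\!\left(p^{2k+2}n + \frac{rp^{2k+1}-1}{8}\right)\equiv 0 \pmod 2.$$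
   Context: For $|q|<1$ and integers $j\ge 1$, $f_j := \prod_{n=1}^{\infty}(1-q^{jn})$. Ramanujan's theta function is $\psi(q) := \sum_{n=0}^{\infty} q^{n(n+1)/2} = f_2^2/f_1$, so that $\psi(-q) = f_1f_4/f_2$. The paper describes $pod_2(n)$ as the number of $2$-regular partitions of $n$ with distinct odd parts (even parts unrestricted), with generating function $\sum_{n\ge0} pod_2(n)q^n = \psi(-q^2)/\psi(-q)$. Ramanujan's tau function is defined by $\Delta(z) = q\prod_{n=1}^{\infty}(1-q^n)^{24} = \sum_{n=1}^{\infty}\tau(n)q^n$. -}

module Defs where

open import Data.Nat as ℕ using (ℕ; zero; suc; _∸_)
open import Data.Nat.Divisibility using (_∣?_)
open import Data.Integer as ℤ using (ℤ; +_; -[1+_]; 0ℤ; 1ℤ; -1ℤ; ∣_∣)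
open import Data.List using (List; []; _∷_; upTo)
open import Data.List.Relation.Unary.Any using (any?)
open import Relation.Nullary.Decidable using (Dec; yes; no; does)
open import Data.Bool using (Bool; true; false; if_then_else_)

Series : Set
Series = ℕ → ℤ

sumTo : ℕ → (ℕ → ℤ) → ℤ
sumTo zero    g = g 0
sumTo (suc n) g = sumTo n g ℤ.+ g (suc n)

infixl 7 _⋆_
_⋆_ : Series → Series → Series
(a ⋆ b) n = sumTo n (λ k → a k ℤ.* b (n ∸ k))

one : Series
one zero    = 1ℤ
one (suc _) = 0ℤ

-- the series 1 - q^d   (used with d ≥ 1)
oneMinus : ℕ → Series
oneMinus d n with does (n ℕ.≟ 0) | does (n ℕ.≟ d)
... | true  | _     = 1ℤ
... | false | true  = -1ℤ
... | false | false = 0ℤ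

-- the series 1/(1 - q^d) = Σ_{k≥0} q^{dk}   (used with d ≥ 1)
geom : ℕ → Series
geom d n = if does (d ∣? n) then 1ℤ else 0ℤ

prodTo : ℕ → (ℕ → Series) → Series
prodTo zero    g = one
prodTo (suc N) g = prodTo N g ⋆ g (suc N)

-- For j ≥ 1 the coefficient of q^n of the infinite product f_j = ∏_{m≥1}(1-q^{jm})
-- (resp. 1/f_j) equals the coefficient of q^n of the truncation with N = n,
-- since the omitted factors are ≡ 1 mod q^{n+1}.
fTrunc : ℕ → ℕ → Series
fTrunc j N = prodTo N (λ m → oneMinus (j ℕ.* m))

fInvTrunc : ℕ → ℕ → Series
fInvTrunc j N = prodTo N (λ m → geom (j ℕ.* m))

pod2 : ℕ → ℤ
pod2 n = (fTrunc 2 n ⋆ fTrunc 2 n ⋆ fTrunc 8 n ⋆ fInvTrunc 1 n ⋆ fInvTrunc 4 n ⋆ fInvTrunc 4 n) n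

fPow : ℕ → ℕ → Series
fPow zero    N = one
fPow (suc e) N = fPow e N ⋆ fTrunc 1 N

-- Ramanujan's tau: Δ = q f₁²⁴ = Σ_{n≥1} τ(n) qⁿ, so τ(n) = [q^{n-1}] f₁²⁴ for n ≥ 1.
tau : ℕ → ℤ
tau zero    = 0ℤ
tau (suc m) = fPow 24 m m

isSquareMod : ℤ → ℕ → Bool
isSquareMod a p = does (any? (λ x → p ∣? ∣ (+ x) ℤ.* (+ x) ℤ.- a ∣) (upTo p))

legendre : ℤ → ℕ → ℤ
legendre a p = if does (p ∣? ∣ a ∣) then 0ℤ
               else (if isSquareMod a p then 1ℤ else -1ℤ)

{-# OPTIONS --safe #-}
-- Modulo 2 the generating function f₂² f₈ / (f₁ f₄²) of pod₂ is f₁³, and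
-- f₁³ ≡ (−q;q)_∞² (q;q)_∞ = ψ(q) = Σₓ q^{T(x)} with T(x) = x(x+1)/2 (Gauss), so pod₂(m) is odd
-- only if m is triangular, i.e. only if 8m + 1 is a square. Gauss's identity is checked
-- coefficientwise from the finite Jacobi triple product
--   ∏_{j=1}^{a} (1 + q^j) ∏_{j=0}^{b−1} (1 + q^j) = Σ_{i+k=a+b} q^{T(i−b)} [a+b choose i]_q
-- at a = 2m, b = 2m + 1, multiplied by (q;q)_{a+b}.
-- On the three progressions of the theorem 8m + 1 equals p(8n) + s, p^{2k} (p(8n) + s) and
-- p^{2k} · p (p(8n) + r): the first is a non-residue modulo p, the second reduces to the first
-- by descent, and the third has odd p-adic valuation.
module Submission where

open import Defs
open import Algebra.Bundles using (CommutativeRing)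
import Algebra.Properties.CommutativeSemigroup as CommutativeSemigroupProperties
import Algebra.Solver.Ring
open import Algebra.Solver.Ring.AlmostCommutativeRing using (fromCommutativeRing; _-Raw-AlmostCommutative⟶_)
open import Data.Bool using (true; false; if_then_else_)
open import Data.Empty using (⊥-elim)
open import Data.Integer as ℤ using (ℤ; +_; 0ℤ; 1ℤ; -1ℤ; ∣_∣)
open import Data.Integer.Divisibility using (_∣_)
import Data.Integer.Properties as ℤₚ
open import Data.Integer.Tactic.RingSolver using (solve-∀)
open import Data.List using (upTo)
open import Data.List.Membership.Propositional using (lose)
open import Data.List.Membership.Propositional.Properties using (∈-upTo⁺)
open import Data.List.Relation.Unary.Any using (any?)
open import Data.Maybe using (Maybe; just; nothing)
open import Data.Nat as ℕ using (ℕ; zero; suc; _+_; _*_; _∸_; _^_; _/_; _%_; _≤_; _<_; z≤n; s≤s; NonZero)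
open import Data.Nat.DivMod using (m≡m%n+[m/n]*n; m%n<n; m*n/n≡m; [m+kn]%n≡m%n; %-distribˡ-*)
import Data.Nat.Divisibility as ℕᵈ
open import Data.Nat.GCD using (gcd; gcd-greatest)
open import Data.Nat.Primality using (Prime; ¬prime[1]; euclidsLemma; prime⇒nonZero; prime⇒irreducible)
import Data.Nat.Properties as ℕₚ
import Data.Nat.Tactic.RingSolver as ℕ-Solver
open import Data.Product using (Σ; _,_; _×_; proj₁; proj₂)
open import Data.Sum using (inj₁; inj₂; reduce)
open import Function using (_∘_)
open import Level using (0ℓ)
open import Relation.Binary.Bundles using (Setoid)
open import Relation.Binary.PropositionalEquality
  using (_≡_; _≢_; refl; sym; trans; cong; cong₂; subst; module ≡-Reasoning)
import Relation.Binary.Reasoning.Setoid as SetoidReasoning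
open import Relation.Nullary using (Dec; yes; no; does; ¬_)
open import Relation.Nullary.Decidable using (dec-true; dec-false)

open CommutativeSemigroupProperties ℤₚ.+-commutativeSemigroup using (interchange)
open CommutativeSemigroupProperties ℕₚ.+-commutativeSemigroup using (x∙yz≈y∙xz; xy∙z≈y∙xz)

-- Formal power series over ℤ

sumTo-cong : ∀ n {g h : ℕ → ℤ} → (∀ k → k ≤ n → g k ≡ h k) → sumTo n g ≡ sumTo n h
sumTo-cong zero    g≡h = g≡h 0 z≤n
sumTo-cong (suc n) g≡h =
  cong₂ ℤ._+_ (sumTo-cong n (λ k k≤n → g≡h k (ℕₚ.m≤n⇒m≤1+n k≤n))) (g≡h (suc n) ℕₚ.≤-refl)

sumTo-+ : ∀ n (g h : ℕ → ℤ) → sumTo n (λ k → g k ℤ.+ h k) ≡ sumTo n g ℤ.+ sumTo n h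
sumTo-+ zero    g h = refl
sumTo-+ (suc n) g h =
  trans (cong (ℤ._+ (g (suc n) ℤ.+ h (suc n))) (sumTo-+ n g h))
        (interchange (sumTo n g) (sumTo n h) (g (suc n)) (h (suc n)))

sumTo-*ˡ : ∀ n c (g : ℕ → ℤ) → sumTo n (λ k → c ℤ.* g k) ≡ c ℤ.* sumTo n g
sumTo-*ˡ zero    c g = refl
sumTo-*ˡ (suc n) c g =
  trans (cong (ℤ._+ c ℤ.* g (suc n)) (sumTo-*ˡ n c g)) (sym (ℤₚ.*-distribˡ-+ c (sumTo n g) (g (suc n))))

sumTo-suc : ∀ n (g : ℕ → ℤ) → sumTo (suc n) g ≡ g 0 ℤ.+ sumTo n (g ∘ suc)
sumTo-suc zero    g = refl
sumTo-suc (suc n) g =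
  trans (cong (ℤ._+ g (suc (suc n))) (sumTo-suc n g)) (ℤₚ.+-assoc (g 0) _ _)

sumTo-reverse : ∀ n (g : ℕ → ℤ) → sumTo n g ≡ sumTo n (λ k → g (n ∸ k))
sumTo-reverse zero    g = refl
sumTo-reverse (suc n) g = begin
  sumTo (suc n) g                              ≡⟨ sumTo-suc n g ⟩
  g 0 ℤ.+ sumTo n (g ∘ suc)                    ≡⟨ ℤₚ.+-comm (g 0) _ ⟩
  sumTo n (g ∘ suc) ℤ.+ g 0                    ≡⟨ cong (ℤ._+ g 0) (sumTo-reverse n (g ∘ suc)) ⟩
  sumTo n (λ k → g (suc (n ∸ k))) ℤ.+ g 0      ≡⟨ cong₂ ℤ._+_ (sumTo-cong n λ k k≤n → cong g (sym (ℕₚ.+-∸-assoc 1 k≤n)))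
                                                              (cong g (sym (ℕₚ.n∸n≡0 n))) ⟩
  sumTo n (λ k → g (suc n ∸ k)) ℤ.+ g (n ∸ n)  ∎
  where open ≡-Reasoning

infixl 6 _⊕_
_⊕_ : Series → Series → Series
(a ⊕ b) n = a n ℤ.+ b n

infix 8 ⊝_
⊝_ : Series → Series
(⊝ a) n = ℤ.- a n

0ₛ : Series
0ₛ _ = 0ℤ

infixr 9 _·_
_·_ : ℤ → Series → Series
(c · a) n = c ℤ.* a n

tail : Series → Series
tail a n = a (suc n)

infix 4 _≈_
record _≈_ (a b : Series) : Set where
  constructor coeffwise
  field coeff : ∀ n → a n ≡ b n
open _≈_ public

⋆-suc : ∀ a b n → (a ⋆ b) (suc n) ≡ a 0 ℤ.* b (suc n) ℤ.+ (tail a ⋆ b) n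
⋆-suc a b n = sumTo-suc n _

coeff-⋆-cong : ∀ {a a′ b b′} → (∀ n → a n ≡ a′ n) → (∀ n → b n ≡ b′ n) → ∀ n → (a ⋆ b) n ≡ (a′ ⋆ b′) n
coeff-⋆-cong a≡ b≡ n = sumTo-cong n λ k _ → cong₂ ℤ._*_ (a≡ k) (b≡ (n ∸ k))

coeff-⋆-comm : ∀ a b n → (a ⋆ b) n ≡ (b ⋆ a) n
coeff-⋆-comm a b n = trans (sumTo-reverse n _) (sumTo-cong n λ k k≤n →
  trans (cong (λ j → a (n ∸ k) ℤ.* b j) (ℕₚ.m∸[m∸n]≡n k≤n)) (ℤₚ.*-comm (a (n ∸ k)) (b k)))

coeff-⋆-distribʳ : ∀ a b c n → ((a ⊕ b) ⋆ c) n ≡ (a ⋆ c) n ℤ.+ (b ⋆ c) n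
coeff-⋆-distribʳ a b c n =
  trans (sumTo-cong n λ k _ → ℤₚ.*-distribʳ-+ (c (n ∸ k)) (a k) (b k)) (sumTo-+ n _ _)

coeff-·-⋆ : ∀ c a b n → (c · a ⋆ b) n ≡ (c · (a ⋆ b)) n
coeff-·-⋆ c a b n = trans (sumTo-cong n λ k _ → ℤₚ.*-assoc c (a k) _) (sumTo-*ˡ n c _)

coeff-⋆-assoc : ∀ a b c n → ((a ⋆ b) ⋆ c) n ≡ (a ⋆ (b ⋆ c)) n
coeff-⋆-assoc a b c zero    = ℤₚ.*-assoc (a 0) (b 0) (c 0)
coeff-⋆-assoc a b c (suc n) = begin
  ((a ⋆ b) ⋆ c) (suc n)
    ≡⟨ ⋆-suc (a ⋆ b) c n ⟩
  a 0 ℤ.* b 0 ℤ.* c (suc n) ℤ.+ (tail (a ⋆ b) ⋆ c) n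
    ≡⟨ cong (λ x → a 0 ℤ.* b 0 ℤ.* c (suc n) ℤ.+ x) (begin
         (tail (a ⋆ b) ⋆ c) n                               ≡⟨ coeff-⋆-cong {b = c} (⋆-suc a b) (λ _ → refl) n ⟩
         ((a 0 · tail b ⊕ tail a ⋆ b) ⋆ c) n                ≡⟨ coeff-⋆-distribʳ (a 0 · tail b) (tail a ⋆ b) c n ⟩
         (a 0 · tail b ⋆ c) n ℤ.+ ((tail a ⋆ b) ⋆ c) n      ≡⟨ cong₂ ℤ._+_ (coeff-·-⋆ (a 0) (tail b) c n)
                                                                           (coeff-⋆-assoc (tail a) b c n) ⟩
         a 0 ℤ.* (tail b ⋆ c) n ℤ.+ (tail a ⋆ (b ⋆ c)) n    ∎) ⟩
  a 0 ℤ.* b 0 ℤ.* c (suc n) ℤ.+ (a 0 ℤ.* (tail b ⋆ c) n ℤ.+ (tail a ⋆ (b ⋆ c)) n)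
    ≡⟨ regroup (a 0) (b 0) (c (suc n)) ((tail b ⋆ c) n) ((tail a ⋆ (b ⋆ c)) n) ⟩
  a 0 ℤ.* (b 0 ℤ.* c (suc n) ℤ.+ (tail b ⋆ c) n) ℤ.+ (tail a ⋆ (b ⋆ c)) n
    ≡⟨ cong (λ x → a 0 ℤ.* x ℤ.+ (tail a ⋆ (b ⋆ c)) n) (sym (⋆-suc b c n)) ⟩
  a 0 ℤ.* (b ⋆ c) (suc n) ℤ.+ (tail a ⋆ (b ⋆ c)) n
    ≡⟨ sym (⋆-suc a (b ⋆ c) n) ⟩
  (a ⋆ (b ⋆ c)) (suc n) ∎
  where
  open ≡-Reasoning
  regroup : ∀ x y z u v → x ℤ.* y ℤ.* z ℤ.+ (x ℤ.* u ℤ.+ v) ≡ x ℤ.* (y ℤ.* z ℤ.+ u) ℤ.+ v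
  regroup = solve-∀

coeff-⋆-zeroˡ : ∀ a n → (0ₛ ⋆ a) n ≡ 0ℤ
coeff-⋆-zeroˡ a zero    = refl
coeff-⋆-zeroˡ a (suc n) = trans (⋆-suc 0ₛ a n) (trans (ℤₚ.+-identityˡ _) (coeff-⋆-zeroˡ a n))

coeff-⋆-identityˡ : ∀ a n → (one ⋆ a) n ≡ a n
coeff-⋆-identityˡ a zero    = ℤₚ.*-identityˡ (a 0)
coeff-⋆-identityˡ a (suc n) = begin
  (one ⋆ a) (suc n)                  ≡⟨ ⋆-suc one a n ⟩
  1ℤ ℤ.* a (suc n) ℤ.+ (0ₛ ⋆ a) n    ≡⟨ cong₂ ℤ._+_ (ℤₚ.*-identityˡ (a (suc n))) (coeff-⋆-zeroˡ a n) ⟩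
  a (suc n) ℤ.+ 0ℤ                   ≡⟨ ℤₚ.+-identityʳ (a (suc n)) ⟩
  a (suc n)                          ∎
  where open ≡-Reasoning

seriesRing : CommutativeRing 0ℓ 0ℓ
seriesRing = record
  { Carrier = Series ; _≈_ = _≈_ ; _+_ = _⊕_ ; _*_ = _⋆_ ; -_ = ⊝_ ; 0# = 0ₛ ; 1# = one
  ; isCommutativeRing = record
    { isRing = record
      { +-isAbelianGroup = record
        { isGroup = record
          { isMonoid = record
            { isSemigroup = record
              { isMagma = record
                { isEquivalence = record
                  { refl  = coeffwise λ _ → refl
                  ; sym   = λ a≈b → coeffwise λ n → sym (coeff a≈b n)
                  ; trans = λ a≈b b≈c → coeffwise λ n → trans (coeff a≈b n) (coeff b≈c n) }
                ; ∙-cong = λ a≈a′ b≈b′ → coeffwise λ n → cong₂ ℤ._+_ (coeff a≈a′ n) (coeff b≈b′ n) }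
              ; assoc = λ a b c → coeffwise λ n → ℤₚ.+-assoc (a n) (b n) (c n) }
            ; identity = (λ a → coeffwise λ n → ℤₚ.+-identityˡ (a n))
                       , (λ a → coeffwise λ n → ℤₚ.+-identityʳ (a n)) }
          ; inverse = (λ a → coeffwise λ n → ℤₚ.+-inverseˡ (a n))
                    , (λ a → coeffwise λ n → ℤₚ.+-inverseʳ (a n))
          ; ⁻¹-cong = λ a≈a′ → coeffwise λ n → cong ℤ.-_ (coeff a≈a′ n) }
        ; comm = λ a b → coeffwise λ n → ℤₚ.+-comm (a n) (b n) }
      ; *-cong = λ a≈a′ b≈b′ → coeffwise (coeff-⋆-cong (coeff a≈a′) (coeff b≈b′))
      ; *-assoc = λ a b c → coeffwise (coeff-⋆-assoc a b c)
      ; *-identity = (λ a → coeffwise (coeff-⋆-identityˡ a))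
                   , (λ a → coeffwise λ n → trans (coeff-⋆-comm a one n) (coeff-⋆-identityˡ a n))
      ; distrib = (λ a b c → coeffwise λ n → trans (coeff-⋆-comm a (b ⊕ c) n)
                     (trans (coeff-⋆-distribʳ b c a n) (cong₂ ℤ._+_ (coeff-⋆-comm b a n) (coeff-⋆-comm c a n))))
                , (λ a b c → coeffwise (coeff-⋆-distribʳ b c a)) }
    ; *-comm = λ a b → coeffwise (coeff-⋆-comm a b) } }

open CommutativeRing seriesRing public
  using (setoid; +-cong; +-congˡ; +-congʳ; *-cong; *-congˡ; *-congʳ; -‿cong;
         +-assoc; +-identityˡ; +-identityʳ; *-identityˡ; zeroʳ; *-identityʳ; *-comm; *-assoc; distribˡ; distribʳ)
  renaming (refl to ≈-refl; sym to ≈-sym; trans to ≈-trans)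

-- Constants c ∈ ℤ are embedded as c · 1 so that the ring solver can use ℤ as its coefficient ring.
private
  const : ℤ → Series
  const c = c · one

  const-homomorphism : ℤ.+-*-rawRing -Raw-AlmostCommutative⟶ fromCommutativeRing seriesRing
  const-homomorphism = record
    { ⟦_⟧    = const
    ; +-homo = λ c d → coeffwise λ n → ℤₚ.*-distribʳ-+ (one n) c d
    ; *-homo = λ c d → coeffwise λ n → trans (ℤₚ.*-assoc c d (one n))
                         (trans (cong (c ℤ.*_) (sym (coeff-⋆-identityˡ (const d) n))) (sym (coeff-·-⋆ c one (const d) n)))
    ; -‿homo = λ c → coeffwise λ n → sym (ℤₚ.neg-distribˡ-* c (one n))
    ; 0-homo = coeffwise λ n → ℤₚ.*-zeroˡ (one n)
    ; 1-homo = coeffwise λ n → ℤₚ.*-identityˡ (one n) }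

  const-≟ : ∀ c d → Maybe (const c ≈ const d)
  const-≟ c d with c ℤ.≟ d
  ... | yes refl = just ≈-refl
  ... | no _     = nothing

open Algebra.Solver.Ring ℤ.+-*-rawRing (fromCommutativeRing seriesRing) const-homomorphism const-≟
  using (solve; _:=_; _:+_; _:*_; :-_; _:-_)
module ≈-Reasoning = SetoidReasoning setoid

prodTo-cong : ∀ N {g h : ℕ → Series} → (∀ j → 1 ≤ j → g j ≈ h j) → prodTo N g ≈ prodTo N h
prodTo-cong zero    g≈h = ≈-refl
prodTo-cong (suc N) g≈h = *-cong (prodTo-cong N g≈h) (g≈h (suc N) (s≤s z≤n))

prodTo-⋆ : ∀ N (g h : ℕ → Series) → prodTo N (λ j → g j ⋆ h j) ≈ prodTo N g ⋆ prodTo N h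
prodTo-⋆ zero    g h = ≈-sym (*-identityʳ one)
prodTo-⋆ (suc N) g h = ≈-trans (*-congʳ {g (suc N) ⋆ h (suc N)} (prodTo-⋆ N g h))
  (solve 4 (λ a b c d → (a :* b) :* (c :* d) := (a :* c) :* (b :* d)) ≈-refl
     (prodTo N g) (prodTo N h) (g (suc N)) (h (suc N)))

prodTo-one : ∀ N → prodTo N (λ _ → one) ≈ one
prodTo-one zero    = ≈-refl
prodTo-one (suc N) = ≈-trans (*-congʳ {one} (prodTo-one N)) (*-identityʳ one)

infix 10 q^_
q^_ : ℕ → Series
(q^ zero)  n       = one n
(q^ suc d) zero    = 0ℤ
(q^ suc d) (suc n) = (q^ d) n

1+q^_ : ℕ → Series
1+q^ d = one ⊕ q^ d

1-q^_ : ℕ → Series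
1-q^ d = one ⊕ ⊝ q^ d

data Offset (d n : ℕ) : Set where
  below : n < d → Offset d n
  above : ∀ t → n ≡ d + t → Offset d n

offset : ∀ d n → Offset d n
offset zero    n       = above n refl
offset (suc d) zero    = below (s≤s z≤n)
offset (suc d) (suc n) with offset d n
... | below n<d    = below (s≤s n<d)
... | above t n≡d+t = above t (cong suc n≡d+t)

q^-coeff-< : ∀ {d n} → n < d → (q^ d) n ≡ 0ℤ
q^-coeff-< {suc d} {zero}  _         = refl
q^-coeff-< {suc d} {suc n} (s≤s n<d) = q^-coeff-< n<d

q^-coeff-+ : ∀ d e t → (q^ (d + e)) (d + t) ≡ (q^ e) t
q^-coeff-+ zero    e t = refl
q^-coeff-+ (suc d) e t = q^-coeff-+ d e t

q^-coeff-self : ∀ d → (q^ d) d ≡ 1ℤ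
q^-coeff-self zero    = refl
q^-coeff-self (suc d) = q^-coeff-self d

q^-coeff-≢ : ∀ {d n} → n ≢ d → (q^ d) n ≡ 0ℤ
q^-coeff-≢ {zero}  {zero}  n≢d = ⊥-elim (n≢d refl)
q^-coeff-≢ {zero}  {suc n} n≢d = refl
q^-coeff-≢ {suc d} {zero}  n≢d = refl
q^-coeff-≢ {suc d} {suc n} n≢d = q^-coeff-≢ (n≢d ∘ cong suc)

q^-⋆-coeff-< : ∀ {d n} a → n < d → (q^ d ⋆ a) n ≡ 0ℤ
q^-⋆-coeff-< {suc d} {zero}  a _         = refl
q^-⋆-coeff-< {suc d} {suc n} a (s≤s n<d) =
  trans (⋆-suc (q^ suc d) a n) (trans (ℤₚ.+-identityˡ _) (q^-⋆-coeff-< a n<d))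

q^-⋆-coeff-+ : ∀ d a n → (q^ d ⋆ a) (d + n) ≡ a n
q^-⋆-coeff-+ zero    a n = coeff-⋆-identityˡ a n
q^-⋆-coeff-+ (suc d) a n =
  trans (⋆-suc (q^ suc d) a (d + n)) (trans (ℤₚ.+-identityˡ _) (q^-⋆-coeff-+ d a n))

q^-+ : ∀ d e → q^ d ⋆ q^ e ≈ q^ (d + e)
q^-+ d e = coeffwise λ n → coeff-+ (offset d n)
  where
  coeff-+ : ∀ {n} → Offset d n → (q^ d ⋆ q^ e) n ≡ (q^ (d + e)) n
  coeff-+ (below n<d)    = trans (q^-⋆-coeff-< (q^ e) n<d) (sym (q^-coeff-< (ℕₚ.<-≤-trans n<d (ℕₚ.m≤m+n d e))))
  coeff-+ (above t refl) = trans (q^-⋆-coeff-+ d (q^ e) t) (sym (q^-coeff-+ d e t))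

q^-cong : ∀ {d e} → d ≡ e → q^ d ≈ q^ e
q^-cong refl = ≈-refl

q^-⋆-q^ : ∀ x y g → q^ x ⋆ (q^ y ⋆ g) ≈ q^ (x + y) ⋆ g
q^-⋆-q^ x y g = ≈-trans (≈-sym (*-assoc (q^ x) (q^ y) g)) (*-congʳ {g} (q^-+ x y))

q^-⋆-q^-exchange : ∀ x y x′ y′ g → x + y ≡ x′ + y′ → q^ x ⋆ (q^ y ⋆ g) ≈ q^ x′ ⋆ (q^ y′ ⋆ g)
q^-⋆-q^-exchange x y x′ y′ g eq =
  ≈-trans (q^-⋆-q^ x y g) (≈-trans (*-congʳ {g} (q^-cong eq)) (≈-sym (q^-⋆-q^ x′ y′ g)))

1+q^-⋆ : ∀ d a → 1+q^ d ⋆ a ≈ a ⊕ q^ d ⋆ a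
1+q^-⋆ d a = ≈-trans (distribʳ a one (q^ d)) (+-congʳ (*-identityˡ a))

-- Gaussian binomials and a finite Jacobi triple product

-- qBinomial i k is the Gaussian binomial coefficient [i + k choose i]_q.
qBinomial : ℕ → ℕ → Series
qBinomial zero    k       = one
qBinomial (suc i) zero    = one
qBinomial (suc i) (suc k) = qBinomial i (suc k) ⊕ q^ suc i ⋆ qBinomial (suc i) k

qBinomial-pascal : ∀ i k → qBinomial (suc i) (suc k) ≈ qBinomial (suc i) k ⊕ q^ suc k ⋆ qBinomial i (suc k)
qBinomial-pascal zero zero = ≈-refl
qBinomial-pascal (suc i) zero = begin
  qBinomial (suc i) 1 ⊕ q^ suc (suc i) ⋆ one           ≈⟨ +-cong (qBinomial-pascal i zero) (≈-sym (q^-⋆-q^ 1 (suc i) one)) ⟩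
  (one ⊕ q^ 1 ⋆ qBinomial i 1) ⊕ q^ 1 ⋆ (q^ suc i ⋆ one) ≈⟨ solve 4 (λ o x g y → (o :+ x :* g) :+ x :* y := o :+ x :* (g :+ y))
                                                               ≈-refl one (q^ 1) (qBinomial i 1) (q^ suc i ⋆ one) ⟩
  one ⊕ q^ 1 ⋆ qBinomial (suc i) 1                       ∎
  where open ≈-Reasoning
qBinomial-pascal zero (suc k) = begin
  one ⊕ q^ 1 ⋆ qBinomial 1 (suc k)                        ≈⟨ +-congˡ {one} (*-congˡ {q^ 1} (qBinomial-pascal zero k)) ⟩
  one ⊕ q^ 1 ⋆ (qBinomial 1 k ⊕ q^ suc k ⋆ one)           ≈⟨ solve 4 (λ o x g y → o :+ x :* (g :+ y) := (o :+ x :* g) :+ x :* y)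
                                                                ≈-refl one (q^ 1) (qBinomial 1 k) (q^ suc k ⋆ one) ⟩
  (one ⊕ q^ 1 ⋆ qBinomial 1 k) ⊕ q^ 1 ⋆ (q^ suc k ⋆ one)  ≈⟨ +-congˡ {one ⊕ q^ 1 ⋆ qBinomial 1 k} (q^-⋆-q^ 1 (suc k) one) ⟩
  qBinomial 1 (suc k) ⊕ q^ suc (suc k) ⋆ one              ∎
  where open ≈-Reasoning
qBinomial-pascal (suc i) (suc k) = begin
  qBinomial (suc i) (suc (suc k)) ⊕ x ⋆ qBinomial (suc (suc i)) (suc k)
    ≈⟨ +-cong (qBinomial-pascal i (suc k)) (*-congˡ {x} (qBinomial-pascal (suc i) k)) ⟩
  (A ⊕ y ⋆ B) ⊕ x ⋆ (C ⊕ q^ suc k ⋆ A)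
    ≈⟨ solve 6 (λ A B C x y z → (A :+ y :* B) :+ x :* (C :+ z) := (A :+ x :* C) :+ (y :* B :+ x :* z))
         ≈-refl A B C x y (q^ suc k ⋆ A) ⟩
  (A ⊕ x ⋆ C) ⊕ (y ⋆ B ⊕ x ⋆ (q^ suc k ⋆ A))
    ≈⟨ +-congˡ {A ⊕ x ⋆ C} (+-congˡ {y ⋆ B} (q^-⋆-q^-exchange (suc (suc i)) (suc k) (suc (suc k)) (suc i) A exponents)) ⟩
  (A ⊕ x ⋆ C) ⊕ (y ⋆ B ⊕ y ⋆ (q^ suc i ⋆ A))
    ≈⟨ +-congˡ {A ⊕ x ⋆ C} (≈-sym (distribˡ y B (q^ suc i ⋆ A))) ⟩
  qBinomial (suc (suc i)) (suc k) ⊕ y ⋆ qBinomial (suc i) (suc (suc k)) ∎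
  where
  open ≈-Reasoning
  A = qBinomial (suc i) (suc k)
  B = qBinomial i (suc (suc k))
  C = qBinomial (suc (suc i)) k
  x = q^ suc (suc i)
  y = q^ suc (suc k)
  exponents : suc (suc i) + suc k ≡ suc (suc k) + suc i
  exponents = trans (ℕₚ.+-comm (suc (suc i)) (suc k)) (cong suc (ℕₚ.+-suc k (suc i)))

triangular : ℕ → ℕ
triangular zero    = 0
triangular (suc x) = triangular x + suc x

-- triangularDiff i b is the triangular number (i − b)(i − b + 1)/2 of the integer i − b.
triangularDiff : ℕ → ℕ → ℕ
triangularDiff i       zero    = triangular i
triangularDiff zero    (suc b) = triangular b
triangularDiff (suc i) (suc b) = triangularDiff i b

triangularDiff-zero : ∀ b → b + triangularDiff 0 b ≡ triangular b
triangularDiff-zero zero    = refl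
triangularDiff-zero (suc b) = ℕₚ.+-comm (suc b) (triangular b)

triangularDiff-suc : ∀ i b → b + triangularDiff (suc i) b ≡ suc i + triangularDiff i b
triangularDiff-suc i       zero    = ℕₚ.+-comm (triangular i) (suc i)
triangularDiff-suc zero    (suc b) = cong suc (triangularDiff-zero b)
triangularDiff-suc (suc i) (suc b) = cong suc (triangularDiff-suc i b)

triangularDiff-exchange : ∀ {x y} i b → x + suc i ≡ y + b → x + triangularDiff (suc i) b ≡ y + triangularDiff i b
triangularDiff-exchange {x} {y} i b eq = ℕₚ.+-cancelˡ-≡ b _ _ (begin
  b + (x + triangularDiff (suc i) b)  ≡⟨ x∙yz≈y∙xz b x _ ⟩
  x + (b + triangularDiff (suc i) b)  ≡⟨ cong (_+_ x) (triangularDiff-suc i b) ⟩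
  x + (suc i + triangularDiff i b)    ≡⟨ ℕₚ.+-assoc x (suc i) _ ⟨
  x + suc i + triangularDiff i b      ≡⟨ cong (_+ triangularDiff i b) eq ⟩
  y + b + triangularDiff i b          ≡⟨ xy∙z≈y∙xz y b _ ⟩
  b + (y + triangularDiff i b)        ∎)
  where open ≡-Reasoning

triangularDiff-triangular : ∀ i b → Σ ℕ λ x → triangularDiff i b ≡ triangular x
triangularDiff-triangular i       zero    = i , refl
triangularDiff-triangular zero    (suc b) = b , refl
triangularDiff-triangular (suc i) (suc b) = triangularDiff-triangular i b

n≤triangular : ∀ n → n ≤ triangular n
n≤triangular zero    = z≤n
n≤triangular (suc n) = ℕₚ.m≤n+m (suc n) (triangular n)

triangularDiff-lowerˡ : ∀ i b → b ≤ suc i + triangularDiff i b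
triangularDiff-lowerˡ i       zero    = z≤n
triangularDiff-lowerˡ zero    (suc b) = s≤s (n≤triangular b)
triangularDiff-lowerˡ (suc i) (suc b) = s≤s (triangularDiff-lowerˡ i b)

triangularDiff-lowerʳ : ∀ i b → i ≤ b + triangularDiff i b
triangularDiff-lowerʳ i       zero    = n≤triangular i
triangularDiff-lowerʳ zero    (suc b) = z≤n
triangularDiff-lowerʳ (suc i) (suc b) = s≤s (triangularDiff-lowerʳ i b)

triangularDiff≤m⇒m≤i×m≤k : ∀ m i k → i + k ≡ (m + m) + suc (m + m) → triangularDiff i (suc (m + m)) ≤ m → m ≤ i × m ≤ k
triangularDiff≤m⇒m≤i×m≤k m i k i+k≡M e≤m = m≤i , m≤k
  where
  n = m + m
  m≤i : m ≤ i
  m≤i = ℕₚ.+-cancelʳ-≤ m m i (ℕₚ.≤-pred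
          (ℕₚ.≤-trans (triangularDiff-lowerˡ i (suc n)) (ℕₚ.+-monoʳ-≤ (suc i) e≤m)))
  i≤1+n+m : i ≤ suc n + m
  i≤1+n+m = ℕₚ.≤-trans (triangularDiff-lowerʳ i (suc n)) (ℕₚ.+-monoʳ-≤ (suc n) e≤m)
  m≤k : m ≤ k
  m≤k = ℕₚ.+-cancelˡ-≤ m m k (ℕₚ.+-cancelˡ-≤ (suc n) n (m + k) (begin
    suc n + n       ≡⟨ ℕₚ.+-comm (suc n) n ⟩
    n + suc n       ≡⟨ i+k≡M ⟨
    i + k           ≤⟨ ℕₚ.+-monoˡ-≤ k i≤1+n+m ⟩
    suc n + m + k   ≡⟨ ℕₚ.+-assoc (suc n) m k ⟩
    suc n + (m + k) ∎))
    where open ℕₚ.≤-Reasoning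

antidiagonalSum : ℕ → (ℕ → ℕ → Series) → Series
antidiagonalSum zero    f = f 0 0
antidiagonalSum (suc M) f = f 0 (suc M) ⊕ antidiagonalSum M (λ i k → f (suc i) k)

antidiagonalSum-cong : ∀ M {f g : ℕ → ℕ → Series} → (∀ i k → i + k ≡ M → f i k ≈ g i k) →
                       antidiagonalSum M f ≈ antidiagonalSum M g
antidiagonalSum-cong zero    f≈g = f≈g 0 0 refl
antidiagonalSum-cong (suc M) f≈g =
  +-cong (f≈g 0 (suc M) refl) (antidiagonalSum-cong M λ i k eq → f≈g (suc i) k (cong suc eq))

antidiagonalSum-⊕ : ∀ M (f g : ℕ → ℕ → Series) →
                    antidiagonalSum M (λ i k → f i k ⊕ g i k) ≈ antidiagonalSum M f ⊕ antidiagonalSum M g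
antidiagonalSum-⊕ zero    f g = ≈-refl
antidiagonalSum-⊕ (suc M) f g =
  ≈-trans (+-congˡ {f 0 (suc M) ⊕ g 0 (suc M)} (antidiagonalSum-⊕ M _ _))
          (solve 4 (λ a b c d → (a :+ b) :+ (c :+ d) := (a :+ c) :+ (b :+ d)) ≈-refl
                 (f 0 (suc M)) (g 0 (suc M)) (antidiagonalSum M (λ i k → f (suc i) k)) (antidiagonalSum M (λ i k → g (suc i) k)))

antidiagonalSum-⋆ : ∀ M c (f : ℕ → ℕ → Series) → antidiagonalSum M (λ i k → c ⋆ f i k) ≈ c ⋆ antidiagonalSum M f
antidiagonalSum-⋆ zero    c f = ≈-refl
antidiagonalSum-⋆ (suc M) c f =
  ≈-trans (+-congˡ {c ⋆ f 0 (suc M)} (antidiagonalSum-⋆ M c (λ i k → f (suc i) k)))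
          (≈-sym (distribˡ c (f 0 (suc M)) (antidiagonalSum M (λ i k → f (suc i) k))))

antidiagonalSum-snoc : ∀ M (f : ℕ → ℕ → Series) →
                       antidiagonalSum (suc M) f ≈ antidiagonalSum M (λ i k → f i (suc k)) ⊕ f (suc M) 0
antidiagonalSum-snoc zero    f = ≈-refl
antidiagonalSum-snoc (suc M) f =
  ≈-trans (+-congˡ {f 0 (suc (suc M))} (antidiagonalSum-snoc M (λ i k → f (suc i) k)))
          (≈-sym (+-assoc (f 0 (suc (suc M))) (antidiagonalSum M (λ i k → f (suc i) (suc k))) (f (suc (suc M)) 0)))

antidiagonalSum-coeff : ∀ M (f : ℕ → ℕ → Series) t → (∀ i k → i + k ≡ M → f i k t ≡ 0ℤ) → antidiagonalSum M f t ≡ 0ℤ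
antidiagonalSum-coeff zero    f t vanish = vanish 0 0 refl
antidiagonalSum-coeff (suc M) f t vanish =
  cong₂ ℤ._+_ (vanish 0 (suc M) refl) (antidiagonalSum-coeff M _ t λ i k eq → vanish (suc i) k (cong suc eq))

Δᵢ : ℕ → ℕ → Series
Δᵢ i zero    = 0ₛ
Δᵢ i (suc k) = q^ suc i ⋆ qBinomial (suc i) k

Δₖ : ℕ → ℕ → Series
Δₖ zero    k = 0ₛ
Δₖ (suc i) k = q^ suc k ⋆ qBinomial i (suc k)

qBinomial-sucˡ : ∀ i k → qBinomial (suc i) k ≈ qBinomial i k ⊕ Δᵢ i k
qBinomial-sucˡ zero    zero    = ≈-sym (+-identityʳ one)
qBinomial-sucˡ (suc i) zero    = ≈-sym (+-identityʳ one)
qBinomial-sucˡ i       (suc k) = ≈-refl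

qBinomial-sucʳ : ∀ i k → qBinomial i (suc k) ≈ qBinomial i k ⊕ Δₖ i k
qBinomial-sucʳ zero    k = ≈-sym (+-identityʳ one)
qBinomial-sucʳ (suc i) k = qBinomial-pascal i k

jacobiSum : ℕ → ℕ → Series
jacobiSum M b = antidiagonalSum M λ i k → q^ triangularDiff i b ⋆ qBinomial i k

q^-triangular : ∀ b g → q^ triangular b ⋆ g ≈ q^ b ⋆ (q^ triangularDiff 0 b ⋆ g)
q^-triangular b g =
  ≈-trans (*-congʳ {g} (q^-cong (sym (triangularDiff-zero b)))) (≈-sym (q^-⋆-q^ b (triangularDiff 0 b) g))

⊕-⋆-0ₛ : ∀ a c → a ⊕ c ⋆ 0ₛ ≈ a
⊕-⋆-0ₛ a c = ≈-trans (+-congˡ {a} (zeroʳ c)) (+-identityʳ a)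

jacobiSum-Δᵢ : ∀ M b → q^ triangular b ⋆ one ⊕ antidiagonalSum M (λ i k → q^ triangularDiff i b ⋆ Δᵢ i k)
                     ≈ q^ b ⋆ jacobiSum M b
jacobiSum-Δᵢ zero    b = ≈-trans (⊕-⋆-0ₛ (q^ triangular b ⋆ one) (q^ triangularDiff 0 b)) (q^-triangular b one)
jacobiSum-Δᵢ (suc M) b = begin
  q^ triangular b ⋆ one ⊕ antidiagonalSum (suc M) terms
    ≈⟨ +-cong (q^-triangular b one) (antidiagonalSum-snoc M terms) ⟩
  first ⊕ (antidiagonalSum M (λ i k → q^ e i ⋆ Δᵢ i (suc k)) ⊕ q^ e (suc M) ⋆ 0ₛ)
    ≈⟨ +-congˡ {first} (⊕-⋆-0ₛ (antidiagonalSum M (λ i k → q^ e i ⋆ Δᵢ i (suc k))) (q^ e (suc M))) ⟩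
  first ⊕ antidiagonalSum M (λ i k → q^ e i ⋆ (q^ suc i ⋆ qBinomial (suc i) k))
    ≈⟨ +-congˡ {first} (antidiagonalSum-cong M λ i k _ →
         q^-⋆-q^-exchange (e i) (suc i) b (e (suc i)) (qBinomial (suc i) k)
           (trans (ℕₚ.+-comm (e i) (suc i)) (sym (triangularDiff-suc i b)))) ⟩
  first ⊕ antidiagonalSum M (λ i k → q^ b ⋆ shifted i k)
    ≈⟨ +-congˡ {first} (antidiagonalSum-⋆ M (q^ b) shifted) ⟩
  first ⊕ q^ b ⋆ antidiagonalSum M shifted
    ≈⟨ distribˡ (q^ b) (q^ e 0 ⋆ one) (antidiagonalSum M shifted) ⟨
  q^ b ⋆ jacobiSum (suc M) b ∎
  where
  open ≈-Reasoning
  e : ℕ → ℕ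
  e i = triangularDiff i b
  terms shifted : ℕ → ℕ → Series
  terms i k = q^ e i ⋆ Δᵢ i k
  shifted i k = q^ e (suc i) ⋆ qBinomial (suc i) k
  first = q^ b ⋆ (q^ e 0 ⋆ one)

jacobiSum-suc-suc : ∀ M b → jacobiSum (suc M) (suc b) ≈ 1+q^ b ⋆ jacobiSum M b
jacobiSum-suc-suc M b = begin
  T ⊕ antidiagonalSum M (λ i k → q^ e i ⋆ qBinomial (suc i) k)
    ≈⟨ +-congˡ {T} (antidiagonalSum-cong M λ i k _ →
         ≈-trans (*-congˡ {q^ e i} (qBinomial-sucˡ i k)) (distribˡ (q^ e i) (qBinomial i k) (Δᵢ i k))) ⟩
  T ⊕ antidiagonalSum M (λ i k → q^ e i ⋆ qBinomial i k ⊕ q^ e i ⋆ Δᵢ i k)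
    ≈⟨ +-congˡ {T} (antidiagonalSum-⊕ M (λ i k → q^ e i ⋆ qBinomial i k) (λ i k → q^ e i ⋆ Δᵢ i k)) ⟩
  T ⊕ (jacobiSum M b ⊕ rest)
    ≈⟨ solve 3 (λ t d r → t :+ (d :+ r) := d :+ (t :+ r)) ≈-refl T (jacobiSum M b) rest ⟩
  jacobiSum M b ⊕ (T ⊕ rest)
    ≈⟨ +-congˡ {jacobiSum M b} (jacobiSum-Δᵢ M b) ⟩
  jacobiSum M b ⊕ q^ b ⋆ jacobiSum M b
    ≈⟨ 1+q^-⋆ b (jacobiSum M b) ⟨
  1+q^ b ⋆ jacobiSum M b ∎
  where
  open ≈-Reasoning
  e : ℕ → ℕ
  e i = triangularDiff i b
  T = q^ triangular b ⋆ one
  rest = antidiagonalSum M (λ i k → q^ e i ⋆ Δᵢ i k)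

q^-triangularDiff-suc : ∀ M a b → a + b ≡ M →
                        q^ triangularDiff (suc M) b ⋆ one ≈ q^ suc a ⋆ (q^ triangularDiff M b ⋆ one)
q^-triangularDiff-suc M a b a+b≡M =
  ≈-trans (*-congʳ {one} (q^-cong (triangularDiff-exchange {0} M b (cong suc (sym a+b≡M)))))
          (≈-sym (q^-⋆-q^ (suc a) (triangularDiff M b) one))

⊕-0ₛ⋆ : ∀ c a → c ⋆ 0ₛ ⊕ a ≈ a
⊕-0ₛ⋆ c a = ≈-trans (+-congʳ {a} (zeroʳ c)) (+-identityˡ a)

jacobiSum-Δₖ : ∀ M a b → a + b ≡ M →
               antidiagonalSum M (λ i k → q^ triangularDiff i b ⋆ Δₖ i k) ⊕ q^ triangularDiff (suc M) b ⋆ one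
               ≈ q^ suc a ⋆ jacobiSum M b
jacobiSum-Δₖ zero    a b a+b≡0 =
  ≈-trans (⊕-0ₛ⋆ (q^ triangularDiff 0 b) (q^ triangularDiff 1 b ⋆ one)) (q^-triangularDiff-suc 0 a b a+b≡0)
jacobiSum-Δₖ (suc M) a b a+b≡1+M = begin
  (q^ e 0 ⋆ 0ₛ ⊕ antidiagonalSum M (λ i k → q^ e (suc i) ⋆ (q^ suc k ⋆ qBinomial i (suc k)))) ⊕ last
    ≈⟨ +-congʳ {last} (⊕-0ₛ⋆ (q^ e 0) (antidiagonalSum M (λ i k → q^ e (suc i) ⋆ (q^ suc k ⋆ qBinomial i (suc k))))) ⟩
  antidiagonalSum M (λ i k → q^ e (suc i) ⋆ (q^ suc k ⋆ qBinomial i (suc k))) ⊕ last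
    ≈⟨ +-cong (antidiagonalSum-cong M λ i k i+k≡M →
                 q^-⋆-q^-exchange (e (suc i)) (suc k) (suc a) (e i) (qBinomial i (suc k))
                   (trans (ℕₚ.+-comm (e (suc i)) (suc k)) (triangularDiff-exchange i b (exponents i k i+k≡M))))
              (q^-triangularDiff-suc (suc M) a b a+b≡1+M) ⟩
  antidiagonalSum M (λ i k → q^ suc a ⋆ terms i k) ⊕ q^ suc a ⋆ (q^ e (suc M) ⋆ one)
    ≈⟨ +-congʳ {q^ suc a ⋆ (q^ e (suc M) ⋆ one)} (antidiagonalSum-⋆ M (q^ suc a) terms) ⟩
  q^ suc a ⋆ antidiagonalSum M terms ⊕ q^ suc a ⋆ (q^ e (suc M) ⋆ one)
    ≈⟨ distribˡ (q^ suc a) (antidiagonalSum M terms) (q^ e (suc M) ⋆ one) ⟨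
  q^ suc a ⋆ (antidiagonalSum M terms ⊕ q^ e (suc M) ⋆ one)
    ≈⟨ *-congˡ {q^ suc a} (antidiagonalSum-snoc M (λ i k → q^ e i ⋆ qBinomial i k)) ⟨
  q^ suc a ⋆ jacobiSum (suc M) b ∎
  where
  open ≈-Reasoning
  e : ℕ → ℕ
  e i = triangularDiff i b
  last = q^ e (suc (suc M)) ⋆ one
  terms : ℕ → ℕ → Series
  terms i k = q^ e i ⋆ qBinomial i (suc k)
  exponents : ∀ i k → i + k ≡ M → suc k + suc i ≡ suc a + b
  exponents i k i+k≡M =
    trans (cong suc (trans (ℕₚ.+-suc k i) (cong suc (trans (ℕₚ.+-comm k i) i+k≡M)))) (cong suc (sym a+b≡1+M))

jacobiSum-suc : ∀ M a b → a + b ≡ M → jacobiSum (suc M) b ≈ 1+q^ suc a ⋆ jacobiSum M b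
jacobiSum-suc M a b a+b≡M = begin
  jacobiSum (suc M) b
    ≈⟨ antidiagonalSum-snoc M (λ i k → q^ e i ⋆ qBinomial i k) ⟩
  antidiagonalSum M (λ i k → q^ e i ⋆ qBinomial i (suc k)) ⊕ last
    ≈⟨ +-congʳ {last} (antidiagonalSum-cong M λ i k _ →
         ≈-trans (*-congˡ {q^ e i} (qBinomial-sucʳ i k)) (distribˡ (q^ e i) (qBinomial i k) (Δₖ i k))) ⟩
  antidiagonalSum M (λ i k → q^ e i ⋆ qBinomial i k ⊕ q^ e i ⋆ Δₖ i k) ⊕ last
    ≈⟨ +-congʳ {last} (antidiagonalSum-⊕ M (λ i k → q^ e i ⋆ qBinomial i k) (λ i k → q^ e i ⋆ Δₖ i k)) ⟩
  (jacobiSum M b ⊕ rest) ⊕ last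
    ≈⟨ +-assoc (jacobiSum M b) rest last ⟩
  jacobiSum M b ⊕ (rest ⊕ last)
    ≈⟨ +-congˡ {jacobiSum M b} (jacobiSum-Δₖ M a b a+b≡M) ⟩
  jacobiSum M b ⊕ q^ suc a ⋆ jacobiSum M b
    ≈⟨ 1+q^-⋆ (suc a) (jacobiSum M b) ⟨
  1+q^ suc a ⋆ jacobiSum M b ∎
  where
  open ≈-Reasoning
  e : ℕ → ℕ
  e i = triangularDiff i b
  last = q^ e (suc M) ⋆ one
  rest = antidiagonalSum M (λ i k → q^ e i ⋆ Δₖ i k)

finiteTripleProduct : ∀ a b → prodTo a 1+q^_ ⋆ prodTo b (λ j → 1+q^ (j ∸ 1)) ≈ jacobiSum (a + b) b
finiteTripleProduct zero    zero    = ≈-refl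
finiteTripleProduct (suc a) zero    = begin
  (prodTo a 1+q^_ ⋆ 1+q^ suc a) ⋆ one   ≈⟨ *-identityʳ (prodTo a 1+q^_ ⋆ 1+q^ suc a) ⟩
  prodTo a 1+q^_ ⋆ 1+q^ suc a           ≈⟨ *-comm (prodTo a 1+q^_) (1+q^ suc a) ⟩
  1+q^ suc a ⋆ prodTo a 1+q^_           ≈⟨ *-congˡ {1+q^ suc a} (≈-trans (≈-sym (*-identityʳ (prodTo a 1+q^_)))
                                                                        (finiteTripleProduct a zero)) ⟩
  1+q^ suc a ⋆ jacobiSum (a + 0) 0      ≈⟨ jacobiSum-suc (a + 0) a 0 refl ⟨
  jacobiSum (suc a + 0) 0               ∎
  where open ≈-Reasoning
finiteTripleProduct a       (suc b) = begin
  A ⋆ (B ⋆ 1+q^ b)                ≈⟨ solve 3 (λ A B x → A :* (B :* x) := x :* (A :* B)) ≈-refl A B (1+q^ b) ⟩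
  1+q^ b ⋆ (A ⋆ B)                ≈⟨ *-congˡ {1+q^ b} (finiteTripleProduct a b) ⟩
  1+q^ b ⋆ jacobiSum (a + b) b    ≈⟨ jacobiSum-suc-suc (a + b) b ⟨
  jacobiSum (suc (a + b)) (suc b) ≡⟨ cong (λ M → jacobiSum M (suc b)) (ℕₚ.+-suc a b) ⟨
  jacobiSum (a + suc b) (suc b)   ∎
  where
  open ≈-Reasoning
  A = prodTo a 1+q^_
  B = prodTo b (λ j → 1+q^ (j ∸ 1))

prodTo-1+q^-pred : ∀ b → prodTo (suc b) (λ j → 1+q^ (j ∸ 1)) ≈ 1+q^ 0 ⋆ prodTo b 1+q^_
prodTo-1+q^-pred zero    = *-comm one (1+q^ 0)
prodTo-1+q^-pred (suc b) =
  ≈-trans (*-congʳ {1+q^ suc b} (prodTo-1+q^-pred b)) (*-assoc (1+q^ 0) (prodTo b 1+q^_) (1+q^ suc b))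

-- Congruences modulo q^(m+1)

infix 4 _≈[_]_
record _≈[_]_ (a : Series) (m : ℕ) (b : Series) : Set where
  constructor agreeUpTo
  field coeff≤ : ∀ t → t ≤ m → a t ≡ b t
open _≈[_]_ public

≈[]-refl : ∀ {a m} → a ≈[ m ] a
≈[]-refl = agreeUpTo λ _ _ → refl

≈[]-setoid : ℕ → Setoid 0ℓ 0ℓ
≈[]-setoid m = record
  { Carrier = Series
  ; _≈_ = _≈[ m ]_
  ; isEquivalence = record
    { refl  = ≈[]-refl
    ; sym   = λ a≈b → agreeUpTo λ t t≤m → sym (coeff≤ a≈b t t≤m)
    ; trans = λ a≈b b≈c → agreeUpTo λ t t≤m → trans (coeff≤ a≈b t t≤m) (coeff≤ b≈c t t≤m) } }

module ≈[]-Reasoning (m : ℕ) = SetoidReasoning (≈[]-setoid m)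

≈⇒≈[] : ∀ {a b} m → a ≈ b → a ≈[ m ] b
≈⇒≈[] m a≈b = agreeUpTo λ t _ → coeff a≈b t

≈[]-mono : ∀ {a b m m′} → m′ ≤ m → a ≈[ m ] b → a ≈[ m′ ] b
≈[]-mono m′≤m a≈b = agreeUpTo λ t t≤m′ → coeff≤ a≈b t (ℕₚ.≤-trans t≤m′ m′≤m)

≈[]-⊕ : ∀ {a a′ b b′ m} → a ≈[ m ] a′ → b ≈[ m ] b′ → a ⊕ b ≈[ m ] a′ ⊕ b′
≈[]-⊕ a≈a′ b≈b′ = agreeUpTo λ t t≤m → cong₂ ℤ._+_ (coeff≤ a≈a′ t t≤m) (coeff≤ b≈b′ t t≤m)

≈[]-⋆ : ∀ {a a′ b b′ m} → a ≈[ m ] a′ → b ≈[ m ] b′ → a ⋆ b ≈[ m ] a′ ⋆ b′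
≈[]-⋆ a≈a′ b≈b′ = agreeUpTo λ t t≤m → sumTo-cong t λ k k≤t →
  cong₂ ℤ._*_ (coeff≤ a≈a′ k (ℕₚ.≤-trans k≤t t≤m)) (coeff≤ b≈b′ (t ∸ k) (ℕₚ.≤-trans (ℕₚ.m∸n≤m t k) t≤m))

≈[]-q^⋆ : ∀ {a b} r m → a ≈[ m ] b → q^ r ⋆ a ≈[ r + m ] q^ r ⋆ b
≈[]-q^⋆ {a} {b} r m a≈b = agreeUpTo λ t t≤r+m → coeff-≤ (offset r t) t≤r+m
  where
  coeff-≤ : ∀ {t} → Offset r t → t ≤ r + m → (q^ r ⋆ a) t ≡ (q^ r ⋆ b) t
  coeff-≤ (below t<r)    _     = trans (q^-⋆-coeff-< a t<r) (sym (q^-⋆-coeff-< b t<r))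
  coeff-≤ (above u refl) u≤m+r = trans (q^-⋆-coeff-+ r a u)
    (trans (coeff≤ a≈b u (ℕₚ.+-cancelˡ-≤ r u m u≤m+r)) (sym (q^-⋆-coeff-+ r b u)))

1-q^≈[]one : ∀ {j m} → m < j → 1-q^ j ≈[ m ] one
1-q^≈[]one m<j = agreeUpTo λ t t≤m →
  trans (cong (λ c → one t ℤ.+ ℤ.- c) (q^-coeff-< (ℕₚ.≤-<-trans t≤m m<j))) (ℤₚ.+-identityʳ (one t))

prodTo-≈[] : ∀ m N (g : ℕ → Series) → (∀ j → m < j → g j ≈[ m ] one) → m ≤ N → prodTo N g ≈[ m ] prodTo m g
prodTo-≈[] m zero    g g≈1 z≤n   = ≈[]-refl
prodTo-≈[] m (suc N) g g≈1 m≤1+N with ℕₚ.m≤n⇒m<n∨m≡n m≤1+N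
... | inj₂ refl       = ≈[]-refl
... | inj₁ (s≤s m≤N) = begin
  prodTo N g ⋆ g (suc N) ≈⟨ ≈[]-⋆ (prodTo-≈[] m N g g≈1 m≤N) (g≈1 (suc N) (s≤s m≤N)) ⟩
  prodTo m g ⋆ one       ≈⟨ ≈⇒≈[] m (*-identityʳ (prodTo m g)) ⟩
  prodTo m g             ∎
  where open ≈[]-Reasoning m

qPochhammer : ℕ → Series
qPochhammer i = prodTo i 1-q^_

-- [i+k choose i]_q (q;q)_i = (q^{k+1};q)_i, whose factors are all ≡ 1 modulo q^{k+1}.
qBinomial-⋆-qPochhammer : ∀ i k → qBinomial i k ⋆ qPochhammer i ≈[ k ] one
qBinomial-⋆-qPochhammer zero    k       = ≈⇒≈[] k (*-identityʳ one)
qBinomial-⋆-qPochhammer (suc i) zero    = begin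
  one ⋆ qPochhammer (suc i)  ≈⟨ ≈⇒≈[] 0 (*-identityˡ (qPochhammer (suc i))) ⟩
  qPochhammer (suc i)        ≈⟨ prodTo-≈[] 0 (suc i) 1-q^_ (λ j → 1-q^≈[]one) z≤n ⟩
  one                        ∎
  where open ≈[]-Reasoning 0
qBinomial-⋆-qPochhammer (suc i) (suc k) = begin
  (A ⊕ x ⋆ B) ⋆ (F ⋆ o)
    ≈⟨ ≈⇒≈[] (suc k) (solve 5 (λ A B x F o → (A :+ x :* B) :* (F :* o) := (A :* F) :* o :+ x :* (B :* (F :* o)))
                             ≈-refl A B x F o) ⟩
  (A ⋆ F) ⋆ o ⊕ x ⋆ (B ⋆ (F ⋆ o))
    ≈⟨ ≈[]-⊕ (≈[]-⋆ (qBinomial-⋆-qPochhammer i (suc k)) (≈[]-refl {o}))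
              (≈[]-mono (s≤s (ℕₚ.m≤n+m k i)) (≈[]-q^⋆ (suc i) k (qBinomial-⋆-qPochhammer (suc i) k))) ⟩
  one ⋆ o ⊕ x ⋆ one
    ≈⟨ ≈⇒≈[] (suc k) (≈-trans (+-cong (*-identityˡ o) (*-identityʳ x))
                               (solve 2 (λ u x → (u :- x) :+ x := u) ≈-refl one x)) ⟩
  one ∎
  where
  open ≈[]-Reasoning (suc k)
  A = qBinomial i (suc k)
  B = qBinomial (suc i) k
  x = q^ suc i
  F = qPochhammer i
  o = 1-q^ suc i

qBinomial-⋆-qPochhammer≥ : ∀ {m} i k N → m ≤ i → m ≤ k → i ≤ N → qBinomial i k ⋆ qPochhammer N ≈[ m ] one
qBinomial-⋆-qPochhammer≥ {m} i k N m≤i m≤k i≤N = begin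
  qBinomial i k ⋆ qPochhammer N  ≈⟨ ≈[]-mono m≤i (≈[]-⋆ (≈[]-refl {qBinomial i k})
                                                        (prodTo-≈[] i N 1-q^_ (λ j → 1-q^≈[]one) i≤N)) ⟩
  qBinomial i k ⋆ qPochhammer i  ≈⟨ ≈[]-mono m≤k (qBinomial-⋆-qPochhammer i k) ⟩
  one                            ∎
  where open ≈[]-Reasoning m

-- Gauss's identity for ψ(q)

-- ψProduct n tends to (−q;q)_∞² (q;q)_∞ = ψ(q) = Σₓ q^{T(x)} (Gauss).
ψProduct : ℕ → Series
ψProduct n = prodTo n 1+q^_ ⋆ prodTo n 1+q^_ ⋆ qPochhammer (n + suc n)

-- At a = n, b = n + 1 the finite triple product contains the factor 1 + q⁰ = 2.
jacobiSum-⋆-qPochhammer : ∀ n → jacobiSum (n + suc n) (suc n) ⋆ qPochhammer (n + suc n) ≈ ψProduct n ⊕ ψProduct n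
jacobiSum-⋆-qPochhammer n = begin
  jacobiSum (n + suc n) (suc n) ⋆ Q               ≈⟨ *-congʳ {Q} (finiteTripleProduct n (suc n)) ⟨
  (P ⋆ prodTo (suc n) (λ j → 1+q^ (j ∸ 1))) ⋆ Q   ≈⟨ *-congʳ {Q} (*-congˡ {P} (prodTo-1+q^-pred n)) ⟩
  (P ⋆ (1+q^ 0 ⋆ P)) ⋆ Q                          ≈⟨ solve 3 (λ p o r → (p :* (o :* p)) :* r := o :* (p :* p :* r))
                                                            ≈-refl P (1+q^ 0) Q ⟩
  1+q^ 0 ⋆ ψProduct n                             ≈⟨ 1+q^-⋆ 0 (ψProduct n) ⟩
  ψProduct n ⊕ q^ 0 ⋆ ψProduct n                  ≈⟨ +-congˡ {ψProduct n} (*-identityˡ (ψProduct n)) ⟩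
  ψProduct n ⊕ ψProduct n                         ∎
  where
  open ≈-Reasoning
  P = prodTo n 1+q^_
  Q = qPochhammer (n + suc n)

-- Up to q^m the i-th term is just q^{T(i − b)}, because T(i − b) ≤ m forces m ≤ i and m ≤ k.
jacobiTerm-coeff : ∀ m → (∀ x → triangular x ≢ m) → ∀ i k → i + k ≡ (m + m) + suc (m + m) →
                   (q^ triangularDiff i (suc (m + m)) ⋆ (qBinomial i k ⋆ qPochhammer ((m + m) + suc (m + m)))) m ≡ 0ℤ
jacobiTerm-coeff m nonTriangular i k i+k≡M = by-offset (offset e m)
  where
  e = triangularDiff i (suc (m + m))
  G⋆Q = qBinomial i k ⋆ qPochhammer ((m + m) + suc (m + m))
  by-offset : Offset e m → (q^ e ⋆ G⋆Q) m ≡ 0ℤ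
  by-offset (below m<e)             = q^-⋆-coeff-< G⋆Q m<e
  by-offset (above zero m≡e+0)      = ⊥-elim (nonTriangular (proj₁ e-triangular)
    (trans (sym (proj₂ e-triangular)) (sym (trans m≡e+0 (ℕₚ.+-identityʳ e)))))
    where
    e-triangular : Σ ℕ λ x → e ≡ triangular x
    e-triangular = triangularDiff-triangular i (suc (m + m))
  by-offset (above (suc t) m≡e+1+t) = begin
    (q^ e ⋆ G⋆Q) m             ≡⟨ cong (q^ e ⋆ G⋆Q) m≡e+1+t ⟩
    (q^ e ⋆ G⋆Q) (e + suc t)   ≡⟨ q^-⋆-coeff-+ e G⋆Q (suc t) ⟩
    G⋆Q (suc t)                ≡⟨ coeff≤ (qBinomial-⋆-qPochhammer≥ i k _ (proj₁ m≤i×m≤k) (proj₂ m≤i×m≤k) i≤M)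
                                         (suc t) 1+t≤m ⟩
    0ℤ                         ∎
    where
    open ≡-Reasoning
    m≤i×m≤k : m ≤ i × m ≤ k
    m≤i×m≤k = triangularDiff≤m⇒m≤i×m≤k m i k i+k≡M (subst (e ≤_) (sym m≡e+1+t) (ℕₚ.m≤m+n e (suc t)))
    i≤M : i ≤ (m + m) + suc (m + m)
    i≤M = subst (i ≤_) i+k≡M (ℕₚ.m≤m+n i k)
    1+t≤m : suc t ≤ m
    1+t≤m = subst (suc t ≤_) (sym m≡e+1+t) (ℕₚ.m≤n+m (suc t) e)

x+x≡0⇒x≡0 : ∀ x → x ℤ.+ x ≡ 0ℤ → x ≡ 0ℤ
x+x≡0⇒x≡0 x x+x≡0 = ℤₚ.*-cancelˡ-≡ (+ 2) x 0ℤ (trans (ℤₚ.*-distribʳ-+ x 1ℤ 1ℤ)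
  (trans (cong₂ ℤ._+_ (ℤₚ.*-identityˡ x) (ℤₚ.*-identityˡ x)) x+x≡0))

ψProduct-coeff-nonTriangular : ∀ m → (∀ x → triangular x ≢ m) → ψProduct (m + m) m ≡ 0ℤ
ψProduct-coeff-nonTriangular m nonTriangular = x+x≡0⇒x≡0 (ψProduct n m) (begin
  ψProduct n m ℤ.+ ψProduct n m            ≡⟨ coeff (jacobiSum-⋆-qPochhammer n) m ⟨
  (jacobiSum M (suc n) ⋆ Q) m              ≡⟨ coeff distributed m ⟩
  antidiagonalSum M terms m                ≡⟨ antidiagonalSum-coeff M terms m (jacobiTerm-coeff m nonTriangular) ⟩
  0ℤ                                       ∎)
  where
  open ≡-Reasoning
  n = m + m
  M = n + suc n
  Q = qPochhammer M
  e : ℕ → ℕ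
  e i = triangularDiff i (suc n)
  terms : ℕ → ℕ → Series
  terms i k = q^ e i ⋆ (qBinomial i k ⋆ Q)
  distributed : jacobiSum M (suc n) ⋆ Q ≈ antidiagonalSum M terms
  distributed = ≈-trans (*-comm (jacobiSum M (suc n)) Q)
    (≈-trans (≈-sym (antidiagonalSum-⋆ M Q (λ i k → q^ e i ⋆ qBinomial i k)))
      (antidiagonalSum-cong M λ i k _ →
        solve 3 (λ r x g → r :* (x :* g) := x :* (g :* r)) ≈-refl Q (q^ e i) (qBinomial i k)))

-- pod₂ modulo 2

infix 4 _≈₂_
record _≈₂_ (a b : Series) : Set where
  constructor mod2
  field
    quotient  : Series
    ≈+2·quotient : a ≈ b ⊕ (quotient ⊕ quotient)
open _≈₂_ public

≈⇒≈₂ : ∀ {a b} → a ≈ b → a ≈₂ b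
≈⇒≈₂ {b = b} a≈b = mod2 0ₛ (≈-trans a≈b (≈-sym (+-identityʳ b)))

≈₂-refl : ∀ {a} → a ≈₂ a
≈₂-refl = ≈⇒≈₂ ≈-refl

≈₂-sym : ∀ {a b} → a ≈₂ b → b ≈₂ a
≈₂-sym {a} {b} (mod2 c a≈b+2c) = mod2 (⊝ c) (≈-trans
  (solve 2 (λ b c → b := (b :+ (c :+ c)) :+ (:- c :+ :- c)) ≈-refl b c)
  (+-congʳ {⊝ c ⊕ ⊝ c} (≈-sym a≈b+2c)))

≈₂-trans : ∀ {a b d} → a ≈₂ b → b ≈₂ d → a ≈₂ d
≈₂-trans {d = d} (mod2 c a≈b+2c) (mod2 c′ b≈d+2c′) = mod2 (c ⊕ c′) (≈-trans a≈b+2c (≈-trans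
  (+-congʳ {c ⊕ c} b≈d+2c′)
  (solve 3 (λ d c c′ → (d :+ (c′ :+ c′)) :+ (c :+ c) := d :+ ((c :+ c′) :+ (c :+ c′))) ≈-refl d c c′)))

≈₂-⋆ : ∀ {a a′ b b′} → a ≈₂ b → a′ ≈₂ b′ → a ⋆ a′ ≈₂ b ⋆ b′
≈₂-⋆ {b = b} {b′ = b′} (mod2 c a≈b+2c) (mod2 c′ a′≈b′+2c′) =
  mod2 ((b ⋆ c′ ⊕ c ⋆ b′) ⊕ (c ⋆ c′ ⊕ c ⋆ c′)) (≈-trans (*-cong a≈b+2c a′≈b′+2c′)
    (solve 4 (λ b c b′ c′ → (b :+ (c :+ c)) :* (b′ :+ (c′ :+ c′))
                        := b :* b′ :+ (((b :* c′ :+ c :* b′) :+ (c :* c′ :+ c :* c′))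
                                     :+ ((b :* c′ :+ c :* b′) :+ (c :* c′ :+ c :* c′))))
       ≈-refl b c b′ c′))

≈₂-setoid : Setoid 0ℓ 0ℓ
≈₂-setoid = record
  { Carrier = Series ; _≈_ = _≈₂_
  ; isEquivalence = record { refl = ≈₂-refl ; sym = ≈₂-sym ; trans = ≈₂-trans } }

module ≈₂-Reasoning = SetoidReasoning ≈₂-setoid

prodTo-≈₂ : ∀ N {g h : ℕ → Series} → (∀ j → g j ≈₂ h j) → prodTo N g ≈₂ prodTo N h
prodTo-≈₂ zero    g≈₂h = ≈₂-refl
prodTo-≈₂ (suc N) g≈₂h = ≈₂-⋆ (prodTo-≈₂ N g≈₂h) (g≈₂h (suc N))

1+q^≈₂1-q^ : ∀ j → 1+q^ j ≈₂ 1-q^ j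
1+q^≈₂1-q^ j = mod2 (q^ j) (solve 2 (λ o x → o :+ x := (o :- x) :+ (x :+ x)) ≈-refl one (q^ j))

1-q^-double : ∀ d → 1-q^ (d + d) ≈₂ 1-q^ d ⋆ 1-q^ d
1-q^-double d = mod2 (x ⊕ ⊝ (x ⋆ x)) (begin
  one ⊕ ⊝ q^ (d + d)
    ≈⟨ +-congˡ {one} (-‿cong (q^-+ d d)) ⟨
  one ⊕ ⊝ (x ⋆ x)
    ≈⟨ solve 2 (λ o x → o :- x :* x := (o :- (x :+ x) :+ x :* x) :+ ((x :- x :* x) :+ (x :- x :* x))) ≈-refl one x ⟩
  (one ⊕ ⊝ (x ⊕ x) ⊕ x ⋆ x) ⊕ ((x ⊕ ⊝ (x ⋆ x)) ⊕ (x ⊕ ⊝ (x ⋆ x)))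
    ≈⟨ +-congʳ {(x ⊕ ⊝ (x ⋆ x)) ⊕ (x ⊕ ⊝ (x ⋆ x))} square ⟨
  1-q^ d ⋆ 1-q^ d ⊕ ((x ⊕ ⊝ (x ⋆ x)) ⊕ (x ⊕ ⊝ (x ⋆ x))) ∎)
  where
  open ≈-Reasoning
  x = q^ d
  square : 1-q^ d ⋆ 1-q^ d ≈ one ⊕ ⊝ (x ⊕ x) ⊕ x ⋆ x
  square = begin
    (one ⊕ ⊝ x) ⋆ (one ⊕ ⊝ x)                 ≈⟨ solve 2 (λ o x → (o :- x) :* (o :- x) := o :* o :- (o :* x :+ o :* x) :+ x :* x)
                                                    ≈-refl one x ⟩
    one ⋆ one ⊕ ⊝ (one ⋆ x ⊕ one ⋆ x) ⊕ x ⋆ x ≈⟨ +-congʳ {x ⋆ x} (+-cong (*-identityʳ one)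
                                                    (-‿cong (+-cong (*-identityˡ x) (*-identityˡ x)))) ⟩
    one ⊕ ⊝ (x ⊕ x) ⊕ x ⋆ x                   ∎

oneMinus≈1-q^ : ∀ {d} → 1 ≤ d → oneMinus d ≈ 1-q^ d
oneMinus≈1-q^ {suc d} _ = coeffwise coeff-≡
  where
  coeff-≡ : ∀ n → oneMinus (suc d) n ≡ (1-q^ suc d) n
  coeff-≡ zero    = refl
  coeff-≡ (suc n) with n ℕ.≟ d
  ... | yes refl rewrite dec-true (suc n ℕ.≟ suc n) refl =
    sym (trans (ℤₚ.+-identityˡ _) (cong ℤ.-_ (q^-coeff-self n)))
  ... | no n≢d   rewrite dec-false (suc n ℕ.≟ suc d) (n≢d ∘ ℕₚ.suc-injective) =
    sym (trans (ℤₚ.+-identityˡ _) (cong ℤ.-_ (q^-coeff-≢ n≢d)))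

geom-∣ : ∀ {d t} → d ℕᵈ.∣ t → geom d t ≡ 1ℤ
geom-∣ {d} {t} d∣t rewrite dec-true (d ℕᵈ.∣? t) d∣t = refl

geom-∤ : ∀ {d t} → ¬ d ℕᵈ.∣ t → geom d t ≡ 0ℤ
geom-∤ {d} {t} d∤t rewrite dec-false (d ℕᵈ.∣? t) d∤t = refl

geom-+ : ∀ d t → geom d (d + t) ≡ geom d t
geom-+ d t = by-dec (d ℕᵈ.∣? t)
  where
  by-dec : Dec (d ℕᵈ.∣ t) → geom d (d + t) ≡ geom d t
  by-dec (yes d∣t) = trans (geom-∣ (ℕᵈ.∣m∣n⇒∣m+n ℕᵈ.∣-refl d∣t)) (sym (geom-∣ d∣t))
  by-dec (no  d∤t) = trans (geom-∤ λ d∣d+t → d∤t (ℕᵈ.∣m+n∣m⇒∣n d∣d+t ℕᵈ.∣-refl)) (sym (geom-∤ d∤t))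

geom-< : ∀ {d t} → t < d → geom d t ≡ one t
geom-< {d} {zero}  _   = geom-∣ (d ℕᵈ.∣0)
geom-< {d} {suc t} t<d = geom-∤ λ d∣1+t → ℕₚ.<⇒≱ t<d (ℕᵈ.∣⇒≤ d∣1+t)

geom-⋆-1-q^ : ∀ {d} → 1 ≤ d → geom d ⋆ 1-q^ d ≈ one
geom-⋆-1-q^ {d} 1≤d = ≈-trans
  (solve 3 (λ g o x → g :* (o :- x) := g :* o :- x :* g) ≈-refl (geom d) one (q^ d))
  (≈-trans (+-congʳ {⊝ (q^ d ⋆ geom d)} (*-identityʳ (geom d))) (coeffwise λ t → coeff-≡ (offset d t)))
  where
  coeff-≡ : ∀ {t} → Offset d t → geom d t ℤ.+ ℤ.- (q^ d ⋆ geom d) t ≡ one t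
  coeff-≡ (below t<d)    = trans (cong (λ c → geom d _ ℤ.+ ℤ.- c) (q^-⋆-coeff-< (geom d) t<d))
                                 (trans (ℤₚ.+-identityʳ _) (geom-< t<d))
  coeff-≡ (above u refl) = trans (cong₂ (λ c c′ → c ℤ.+ ℤ.- c′) (geom-+ d u) (q^-⋆-coeff-+ d (geom d) u))
                                 (trans (ℤₚ.+-inverseʳ (geom d u)) (sym (one-+ 1≤d)))
    where
    one-+ : ∀ {d} → 1 ≤ d → one (d + u) ≡ 0ℤ
    one-+ {suc d} _ = refl

fTrunc≈ : ∀ j N → 1 ≤ j → fTrunc j N ≈ prodTo N (λ i → 1-q^ (j * i))
fTrunc≈ (suc j) N _ = prodTo-cong N λ { (suc i) _ → oneMinus≈1-q^ (s≤s z≤n) }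

fInvTrunc-⋆-fTrunc : ∀ j N → 1 ≤ j → fInvTrunc j N ⋆ fTrunc j N ≈ one
fInvTrunc-⋆-fTrunc j N 1≤j = begin
  fInvTrunc j N ⋆ fTrunc j N                                    ≈⟨ *-congˡ {fInvTrunc j N} (fTrunc≈ j N 1≤j) ⟩
  prodTo N (λ i → geom (j * i)) ⋆ prodTo N (λ i → 1-q^ (j * i)) ≈⟨ prodTo-⋆ N (λ i → geom (j * i)) (λ i → 1-q^ (j * i)) ⟨
  prodTo N (λ i → geom (j * i) ⋆ 1-q^ (j * i))                  ≈⟨ prodTo-cong N (λ i 1≤i → geom-⋆-1-q^ (ℕₚ.*-mono-≤ 1≤j 1≤i)) ⟩
  prodTo N (λ _ → one)                                          ≈⟨ prodTo-one N ⟩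
  one                                                           ∎
  where open ≈-Reasoning

fTrunc-double : ∀ j N → 1 ≤ j → fTrunc (j + j) N ≈₂ fTrunc j N ⋆ fTrunc j N
fTrunc-double j N 1≤j = begin
  fTrunc (j + j) N                                              ≈⟨ ≈⇒≈₂ (fTrunc≈ (j + j) N (ℕₚ.≤-trans 1≤j (ℕₚ.m≤m+n j j))) ⟩
  prodTo N (λ i → 1-q^ ((j + j) * i))                           ≈⟨ ≈⇒≈₂ (prodTo-cong N λ i _ → q^-double-cong i) ⟩
  prodTo N (λ i → 1-q^ (j * i + j * i))                         ≈⟨ prodTo-≈₂ N (λ i → 1-q^-double (j * i)) ⟩
  prodTo N (λ i → 1-q^ (j * i) ⋆ 1-q^ (j * i))                  ≈⟨ ≈⇒≈₂ (prodTo-⋆ N (λ i → 1-q^ (j * i)) (λ i → 1-q^ (j * i))) ⟩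
  prodTo N (λ i → 1-q^ (j * i)) ⋆ prodTo N (λ i → 1-q^ (j * i)) ≈⟨ ≈⇒≈₂ (*-cong (fTrunc≈ j N 1≤j) (fTrunc≈ j N 1≤j)) ⟨
  fTrunc j N ⋆ fTrunc j N                                       ∎
  where
  open ≈₂-Reasoning
  q^-double-cong : ∀ i → 1-q^ ((j + j) * i) ≈ 1-q^ (j * i + j * i)
  q^-double-cong i = +-congˡ {one} (-‿cong (q^-cong (ℕₚ.*-distribʳ-+ i j j)))

fTrunc-1 : ∀ N → fTrunc 1 N ≈ qPochhammer N
fTrunc-1 N = ≈-trans (fTrunc≈ 1 N (s≤s z≤n)) (prodTo-cong N λ i _ → +-congˡ {one} (-‿cong (q^-cong (ℕₚ.*-identityˡ i))))

-- Modulo 2, f₂ ≡ f₁² and f₈ ≡ f₄², so f₂² f₈ / (f₁ f₄²) ≡ f₁³.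
pod2Series≈₂qPochhammer³ : ∀ N →
  fTrunc 2 N ⋆ fTrunc 2 N ⋆ fTrunc 8 N ⋆ fInvTrunc 1 N ⋆ fInvTrunc 4 N ⋆ fInvTrunc 4 N
    ≈₂ qPochhammer N ⋆ qPochhammer N ⋆ qPochhammer N
pod2Series≈₂qPochhammer³ N = begin
  fTrunc 2 N ⋆ fTrunc 2 N ⋆ fTrunc 8 N ⋆ g₁ ⋆ g₄ ⋆ g₄
    ≈⟨ ≈₂-⋆ (≈₂-⋆ (≈₂-⋆ (≈₂-⋆ (≈₂-⋆ f₂≈₂f₁² f₂≈₂f₁²) f₈≈₂f₄²) (≈₂-refl {g₁})) (≈₂-refl {g₄})) (≈₂-refl {g₄}) ⟩
  (f₁ ⋆ f₁) ⋆ (f₁ ⋆ f₁) ⋆ (f₄ ⋆ f₄) ⋆ g₁ ⋆ g₄ ⋆ g₄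
    ≈⟨ ≈⇒≈₂ (solve 5 (λ a b g h k → (a :* a) :* (a :* a) :* (b :* b) :* g :* h :* k
                                   := (a :* a :* a) :* ((g :* a) :* ((h :* b) :* (k :* b))))
                    ≈-refl f₁ f₄ g₁ g₄ g₄) ⟩
  (f₁ ⋆ f₁ ⋆ f₁) ⋆ ((g₁ ⋆ f₁) ⋆ ((g₄ ⋆ f₄) ⋆ (g₄ ⋆ f₄)))
    ≈⟨ ≈⇒≈₂ (*-congˡ {f₁ ⋆ f₁ ⋆ f₁} (*-cong g₁f₁≈1 (*-cong g₄f₄≈1 g₄f₄≈1))) ⟩
  (f₁ ⋆ f₁ ⋆ f₁) ⋆ (one ⋆ (one ⋆ one))
    ≈⟨ ≈⇒≈₂ (≈-trans (*-congˡ {f₁ ⋆ f₁ ⋆ f₁} (≈-trans (*-identityˡ (one ⋆ one)) (*-identityˡ one)))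
                     (*-identityʳ (f₁ ⋆ f₁ ⋆ f₁))) ⟩
  f₁ ⋆ f₁ ⋆ f₁
    ≈⟨ ≈⇒≈₂ (*-cong (*-cong (fTrunc-1 N) (fTrunc-1 N)) (fTrunc-1 N)) ⟩
  qPochhammer N ⋆ qPochhammer N ⋆ qPochhammer N ∎
  where
  open ≈₂-Reasoning
  f₁ = fTrunc 1 N
  f₄ = fTrunc 4 N
  g₁ = fInvTrunc 1 N
  g₄ = fInvTrunc 4 N
  f₂≈₂f₁² : fTrunc 2 N ≈₂ f₁ ⋆ f₁
  f₂≈₂f₁² = fTrunc-double 1 N (s≤s z≤n)
  f₈≈₂f₄² : fTrunc 8 N ≈₂ f₄ ⋆ f₄
  f₈≈₂f₄² = fTrunc-double 4 N (s≤s z≤n)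
  g₁f₁≈1 : g₁ ⋆ f₁ ≈ one
  g₁f₁≈1 = fInvTrunc-⋆-fTrunc 1 N (s≤s z≤n)
  g₄f₄≈1 : g₄ ⋆ f₄ ≈ one
  g₄f₄≈1 = fInvTrunc-⋆-fTrunc 4 N (s≤s z≤n)

8*triangular+1 : ∀ x → 8 * triangular x + 1 ≡ (2 * x + 1) * (2 * x + 1)
8*triangular+1 zero    = refl
8*triangular+1 (suc x) = begin
  8 * (triangular x + suc x) + 1          ≡⟨ split (triangular x) x ⟩
  (8 * triangular x + 1) + 8 * suc x      ≡⟨ cong (_+ 8 * suc x) (8*triangular+1 x) ⟩
  (2 * x + 1) * (2 * x + 1) + 8 * suc x   ≡⟨ complete x ⟩
  (2 * suc x + 1) * (2 * suc x + 1)       ∎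
  where
  open ≡-Reasoning
  split : ∀ t x → 8 * (t + suc x) + 1 ≡ (8 * t + 1) + 8 * suc x
  split = ℕ-Solver.solve-∀
  complete : ∀ x → (2 * x + 1) * (2 * x + 1) + 8 * suc x ≡ (2 * suc x + 1) * (2 * suc x + 1)
  complete = ℕ-Solver.solve-∀

nonSquare⇒nonTriangular : ∀ {m} → (∀ w → w * w ≢ 8 * m + 1) → ∀ x → triangular x ≢ m
nonSquare⇒nonTriangular nonSquare x Tx≡m =
  nonSquare (2 * x + 1) (trans (sym (8*triangular+1 x)) (cong (λ t → 8 * t + 1) Tx≡m))

2∣x+x : ∀ x → + 2 ∣ x ℤ.+ x
2∣x+x x = ℕᵈ.divides ∣ x ∣ (begin
  ∣ x ℤ.+ x ∣    ≡⟨ cong ∣_∣ (x+x≡2*x x) ⟩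
  ∣ + 2 ℤ.* x ∣  ≡⟨ ℤₚ.abs-* (+ 2) x ⟩
  2 * ∣ x ∣      ≡⟨ ℕₚ.*-comm 2 ∣ x ∣ ⟩
  ∣ x ∣ * 2      ∎)
  where
  open ≡-Reasoning
  x+x≡2*x : ∀ x → x ℤ.+ x ≡ + 2 ℤ.* x
  x+x≡2*x = solve-∀

pod2-even : ∀ m → (∀ w → w * w ≢ 8 * m + 1) → + 2 ∣ pod2 m
pod2-even m nonSquare = subst (+ 2 ∣_) (sym pod2≡c+c) (2∣x+x (c₁ ℤ.+ c₂))
  where
  n = m + m
  M = n + suc n
  F = qPochhammer
  pod2≈₂F³ : fTrunc 2 m ⋆ fTrunc 2 m ⋆ fTrunc 8 m ⋆ fInvTrunc 1 m ⋆ fInvTrunc 4 m ⋆ fInvTrunc 4 m ≈₂ F m ⋆ F m ⋆ F m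
  pod2≈₂F³ = pod2Series≈₂qPochhammer³ m
  F≈₂ψ : F n ⋆ F n ⋆ F M ≈₂ ψProduct n
  F≈₂ψ = ≈₂-⋆ (≈₂-⋆ F≈₂P F≈₂P) (≈₂-refl {F M})
    where
    F≈₂P : F n ≈₂ prodTo n 1+q^_
    F≈₂P = prodTo-≈₂ n (λ j → ≈₂-sym (1+q^≈₂1-q^ j))
  truncation : F n ⋆ F n ⋆ F M ≈[ m ] F m ⋆ F m ⋆ F m
  truncation = ≈[]-⋆ (≈[]-⋆ (trunc n (ℕₚ.m≤m+n m m)) (trunc n (ℕₚ.m≤m+n m m)))
                     (trunc M (ℕₚ.≤-trans (ℕₚ.m≤m+n m m) (ℕₚ.m≤m+n n (suc n))))
    where
    trunc : ∀ N → m ≤ N → F N ≈[ m ] F m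
    trunc N = prodTo-≈[] m N 1-q^_ (λ j → 1-q^≈[]one)
  c₁ = quotient pod2≈₂F³ m
  c₂ = quotient F≈₂ψ m
  pod2≡c+c : pod2 m ≡ (c₁ ℤ.+ c₂) ℤ.+ (c₁ ℤ.+ c₂)
  pod2≡c+c = begin
    pod2 m                                            ≡⟨ coeff (≈+2·quotient pod2≈₂F³) m ⟩
    (F m ⋆ F m ⋆ F m) m ℤ.+ (c₁ ℤ.+ c₁)               ≡⟨ cong (ℤ._+ (c₁ ℤ.+ c₁)) (coeff≤ truncation m ℕₚ.≤-refl) ⟨
    (F n ⋆ F n ⋆ F M) m ℤ.+ (c₁ ℤ.+ c₁)               ≡⟨ cong (ℤ._+ (c₁ ℤ.+ c₁)) (coeff (≈+2·quotient F≈₂ψ) m) ⟩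
    (ψProduct n m ℤ.+ (c₂ ℤ.+ c₂)) ℤ.+ (c₁ ℤ.+ c₁)    ≡⟨ cong (λ z → (z ℤ.+ (c₂ ℤ.+ c₂)) ℤ.+ (c₁ ℤ.+ c₁))
                                                           (ψProduct-coeff-nonTriangular m (nonSquare⇒nonTriangular nonSquare)) ⟩
    (0ℤ ℤ.+ (c₂ ℤ.+ c₂)) ℤ.+ (c₁ ℤ.+ c₁)              ≡⟨ cong (ℤ._+ (c₁ ℤ.+ c₁)) (ℤₚ.+-identityˡ (c₂ ℤ.+ c₂)) ⟩
    (c₂ ℤ.+ c₂) ℤ.+ (c₁ ℤ.+ c₁)                       ≡⟨ regroup c₁ c₂ ⟩
    (c₁ ℤ.+ c₂) ℤ.+ (c₁ ℤ.+ c₂)                       ∎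
    where
    open ≡-Reasoning
    regroup : ∀ a b → (b ℤ.+ b) ℤ.+ (a ℤ.+ a) ≡ (a ℤ.+ b) ℤ.+ (a ℤ.+ b)
    regroup = solve-∀

-- Squares modulo p and modulo 8

NonResidue : ℕ → ℕ → Set
NonResidue s p = ∀ y → y < p → ¬ p ℕᵈ.∣ ∣ + y ℤ.* + y ℤ.- + s ∣

legendre≡-1⇒nonResidue : ∀ {s p} → legendre (+ s) p ≡ -1ℤ → NonResidue s p
legendre≡-1⇒nonResidue {s} {p} legendre≡-1 y y<p p∣y²-s = true≢false (begin
  true                 ≡⟨ dec-true (any? (λ x → p ℕᵈ.∣? ∣ + x ℤ.* + x ℤ.- + s ∣) (upTo p))
                                   (lose (∈-upTo⁺ y<p) p∣y²-s) ⟨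
  isSquareMod (+ s) p  ≡⟨ nonSquare (does (p ℕᵈ.∣? ∣ + s ∣)) (isSquareMod (+ s) p) legendre≡-1 ⟩
  false                ∎)
  where
  open ≡-Reasoning
  true≢false : true ≢ false
  true≢false ()
  nonSquare : ∀ b₁ b₂ → (if b₁ then 0ℤ else (if b₂ then 1ℤ else -1ℤ)) ≡ -1ℤ → b₂ ≡ false
  nonSquare false false _ = refl

nonResidue⇒≢square : ∀ {s p} .{{_ : NonZero p}} → NonResidue s p → ∀ w K → w * w ≢ p * K + s
nonResidue⇒≢square {s} {p} nonResidue w K w²≡pK+s =
  nonResidue y (m%n<n w p) (ℕᵈ.divides ∣ z ∣ (begin
    ∣ + y ℤ.* + y ℤ.- + s ∣  ≡⟨ cong ∣_∣ y²-s≡p*z ⟩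
    ∣ + p ℤ.* z ∣            ≡⟨ ℤₚ.abs-* (+ p) z ⟩
    p * ∣ z ∣                ≡⟨ ℕₚ.*-comm p ∣ z ∣ ⟩
    ∣ z ∣ * p                ∎))
  where
  open ≡-Reasoning
  y = w % p
  q = w / p
  z = + K ℤ.- (+ 2 ℤ.* + y ℤ.* + q ℤ.+ + p ℤ.* + q ℤ.* + q)
  w≡y+qp : + w ≡ + y ℤ.+ + q ℤ.* + p
  w≡y+qp = trans (cong +_ (m≡m%n+[m/n]*n w p)) (trans (ℤₚ.pos-+ y (q * p)) (cong (ℤ._+_ (+ y)) (ℤₚ.pos-* q p)))
  s≡w²-pK : + s ≡ + w ℤ.* + w ℤ.- + p ℤ.* + K
  s≡w²-pK = begin
    + s                                ≡⟨ cancel (+ p ℤ.* + K) (+ s) ⟨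
    + p ℤ.* + K ℤ.+ + s ℤ.- + p ℤ.* + K ≡⟨ cong (λ c → c ℤ.- + p ℤ.* + K) (begin
      + p ℤ.* + K ℤ.+ + s                ≡⟨ cong (ℤ._+ + s) (ℤₚ.pos-* p K) ⟨
      + (p * K) ℤ.+ + s                  ≡⟨ ℤₚ.pos-+ (p * K) s ⟨
      + (p * K + s)                      ≡⟨ cong +_ w²≡pK+s ⟨
      + (w * w)                          ≡⟨ ℤₚ.pos-* w w ⟩
      + w ℤ.* + w                        ∎) ⟩
    + w ℤ.* + w ℤ.- + p ℤ.* + K        ∎
    where
    cancel : ∀ a b → a ℤ.+ b ℤ.- a ≡ b
    cancel = solve-∀
  y²-s≡p*z : + y ℤ.* + y ℤ.- + s ≡ + p ℤ.* z
  y²-s≡p*z = begin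
    + y ℤ.* + y ℤ.- + s                               ≡⟨ cong (λ c → + y ℤ.* + y ℤ.- c) s≡w²-pK ⟩
    + y ℤ.* + y ℤ.- (+ w ℤ.* + w ℤ.- + p ℤ.* + K)     ≡⟨ cong (λ c → + y ℤ.* + y ℤ.- (c ℤ.* c ℤ.- + p ℤ.* + K)) w≡y+qp ⟩
    + y ℤ.* + y ℤ.- ((+ y ℤ.+ + q ℤ.* + p) ℤ.* (+ y ℤ.+ + q ℤ.* + p) ℤ.- + p ℤ.* + K)
                                                      ≡⟨ expand (+ y) (+ q) (+ p) (+ K) ⟩
    + p ℤ.* z                                         ∎
    where
    expand : ∀ y q p K → y ℤ.* y ℤ.- ((y ℤ.+ q ℤ.* p) ℤ.* (y ℤ.+ q ℤ.* p) ℤ.- p ℤ.* K)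
                         ≡ p ℤ.* (K ℤ.- (+ 2 ℤ.* y ℤ.* q ℤ.+ p ℤ.* q ℤ.* q))
    expand = solve-∀

p^[2+2k] : ∀ p k → p ^ (2 * suc k) ≡ p * p * p ^ (2 * k)
p^[2+2k] p k = trans (cong (p ^_) (ℕₚ.*-suc 2 k)) (sym (ℕₚ.*-assoc p p (p ^ (2 * k))))

prime∣square⇒∣ : ∀ {p} w → Prime p → p ℕᵈ.∣ w * w → p ℕᵈ.∣ w
prime∣square⇒∣ w pr p∣w² = reduce (euclidsLemma w w pr p∣w²)

square-cancel : ∀ {p} → Prime p → ∀ w Y → w * w ≡ p * p * Y → Σ ℕ λ v → v * v ≡ Y
square-cancel {p} pr w Y w²≡p²Y = cancel (prime∣square⇒∣ w pr (ℕᵈ.divides (p * Y) (trans w²≡p²Y (regroup p Y))))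
  where
  instance _ = prime⇒nonZero pr
  regroup : ∀ p Y → p * p * Y ≡ p * Y * p
  regroup = ℕ-Solver.solve-∀
  regroup′ : ∀ p v → p * p * (v * v) ≡ v * p * (v * p)
  regroup′ = ℕ-Solver.solve-∀
  cancel : p ℕᵈ.∣ w → Σ ℕ λ v → v * v ≡ Y
  cancel (ℕᵈ.divides v w≡vp) = v , ℕₚ.*-cancelˡ-≡ (v * v) Y (p * p) {{ℕₚ.m*n≢0 p p}}
    (trans (regroup′ p v) (trans (cong (λ u → u * u) (sym w≡vp)) w²≡p²Y))

square-descent : ∀ {p} → Prime p → ∀ k w X → w * w ≡ p ^ (2 * k) * X → Σ ℕ λ v → v * v ≡ X
square-descent     pr zero    w X w²≡X     = w , trans w²≡X (ℕₚ.+-identityʳ X)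
square-descent {p} pr (suc k) w X w²≡p²ᵏX =
  let v , v²≡p²ᵏX = square-cancel pr w (p ^ (2 * k) * X) (begin
        w * w                      ≡⟨ w²≡p²ᵏX ⟩
        p ^ (2 * suc k) * X        ≡⟨ cong (_* X) (p^[2+2k] p k) ⟩
        p * p * p ^ (2 * k) * X    ≡⟨ ℕₚ.*-assoc (p * p) (p ^ (2 * k)) X ⟩
        p * p * (p ^ (2 * k) * X)  ∎)
  in square-descent pr k v X v²≡p²ᵏX
  where open ≡-Reasoning

8*[[x∸1]/8]+1 : ∀ x → x % 8 ≡ 1 → 8 * ((x ∸ 1) / 8) + 1 ≡ x
8*[[x∸1]/8]+1 x x%8≡1 = begin
  8 * ((x ∸ 1) / 8) + 1           ≡⟨ cong (λ y → 8 * ((y ∸ 1) / 8) + 1) x≡1+q*8 ⟩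
  8 * ((q * 8) / 8) + 1           ≡⟨ cong (λ z → 8 * z + 1) (m*n/n≡m q 8) ⟩
  8 * q + 1                       ≡⟨ ℕₚ.+-comm (8 * q) 1 ⟩
  suc (8 * q)                     ≡⟨ cong suc (ℕₚ.*-comm 8 q) ⟩
  suc (q * 8)                     ≡⟨ x≡1+q*8 ⟨
  x                               ∎
  where
  open ≡-Reasoning
  q = x / 8
  x≡1+q*8 : x ≡ 1 + q * 8
  x≡1+q*8 = trans (m≡m%n+[m/n]*n x 8) (cong (_+ q * 8) x%8≡1)

8*[A+[x∸1]/8]+1 : ∀ A x → x % 8 ≡ 1 → 8 * (A + (x ∸ 1) / 8) + 1 ≡ 8 * A + x
8*[A+[x∸1]/8]+1 A x x%8≡1 = begin
  8 * (A + (x ∸ 1) / 8) + 1        ≡⟨ cong (_+ 1) (ℕₚ.*-distribˡ-+ 8 A ((x ∸ 1) / 8)) ⟩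
  8 * A + 8 * ((x ∸ 1) / 8) + 1    ≡⟨ ℕₚ.+-assoc (8 * A) _ 1 ⟩
  8 * A + (8 * ((x ∸ 1) / 8) + 1)  ≡⟨ cong (_+_ (8 * A)) (8*[[x∸1]/8]+1 x x%8≡1) ⟩
  8 * A + x                        ∎
  where open ≡-Reasoning

%8≡1-* : ∀ a b → a % 8 ≡ 1 → b % 8 ≡ 1 → (a * b) % 8 ≡ 1
%8≡1-* a b a%8≡1 b%8≡1 = trans (%-distribˡ-* a b 8) (cong₂ (λ x y → (x * y) % 8) a%8≡1 b%8≡1)

%8≡1-^ : ∀ a k → a % 8 ≡ 1 → (a ^ k) % 8 ≡ 1
%8≡1-^ a zero    _      = refl
%8≡1-^ a (suc k) a%8≡1 = %8≡1-* a (a ^ k) a%8≡1 (%8≡1-^ a k a%8≡1)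

prime≢2⇒odd : ∀ {p} → Prime p → p ≢ 2 → Σ ℕ λ u → p ≡ 2 * u + 1
prime≢2⇒odd {p} pr p≢2 = by-parity (p % 2) (m%n<n p 2) (m≡m%n+[m/n]*n p 2)
  where
  by-parity : ∀ ρ → ρ < 2 → p ≡ ρ + p / 2 * 2 → Σ ℕ λ u → p ≡ 2 * u + 1
  by-parity 0 _ p≡2q with prime⇒irreducible pr (ℕᵈ.divides (p / 2) p≡2q)
  ... | inj₁ ()
  ... | inj₂ 2≡p = ⊥-elim (p≢2 (sym 2≡p))
  by-parity 1 _ p≡1+2q = p / 2 , trans p≡1+2q (trans (ℕₚ.+-comm 1 _) (cong (_+ 1) (ℕₚ.*-comm (p / 2) 2)))
  by-parity (suc (suc ρ)) (s≤s (s≤s ())) _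

oddPrime^[2k]%8≡1 : ∀ {p} → Prime p → p ≢ 2 → ∀ k → (p ^ (2 * k)) % 8 ≡ 1
oddPrime^[2k]%8≡1 {p} pr p≢2 k = subst (λ x → x % 8 ≡ 1) (ℕₚ.^-*-assoc p 2 k) (%8≡1-^ (p ^ 2) k p²%8≡1)
  where
  u = proj₁ (prime≢2⇒odd pr p≢2)
  p²%8≡1 : (p ^ 2) % 8 ≡ 1
  p²%8≡1 = begin
    (p * (p * 1)) % 8                    ≡⟨ cong (λ x → (p * x) % 8) (ℕₚ.*-identityʳ p) ⟩
    (p * p) % 8                          ≡⟨ cong (λ x → (x * x) % 8) (proj₂ (prime≢2⇒odd pr p≢2)) ⟩
    ((2 * u + 1) * (2 * u + 1)) % 8      ≡⟨ cong (_% 8) (8*triangular+1 u) ⟨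
    (8 * triangular u + 1) % 8           ≡⟨ cong (_% 8) (trans (ℕₚ.+-comm (8 * triangular u) 1)
                                                                (cong suc (ℕₚ.*-comm 8 (triangular u)))) ⟩
    (1 + triangular u * 8) % 8           ≡⟨ [m+kn]%n≡m%n 1 (triangular u) 8 ⟩
    1                                    ∎
    where open ≡-Reasoning

-- p (p K + r) has odd p-adic valuation when p ∤ r.
coprime⇒p[pK+r]≢square : ∀ {p r} → Prime p → gcd r p ≡ 1 → ∀ v K → v * v ≢ p * (p * K + r)
coprime⇒p[pK+r]≢square {p} {r} pr gcd≡1 v K v²≡p[pK+r] =
  ¬prime[1] (subst Prime p≡1 pr)
  where
  instance _ = prime⇒nonZero pr
  p∣v : p ℕᵈ.∣ v
  p∣v = prime∣square⇒∣ v pr (ℕᵈ.divides (p * K + r) (trans v²≡p[pK+r] (ℕₚ.*-comm p (p * K + r))))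
  u = ℕᵈ._∣_.quotient p∣v
  pu²≡pK+r : p * (u * u) ≡ p * K + r
  pu²≡pK+r = ℕₚ.*-cancelˡ-≡ (p * (u * u)) (p * K + r) p (begin
    p * (p * (u * u))  ≡⟨ regroup p u ⟩
    u * p * (u * p)    ≡⟨ cong (λ x → x * x) (ℕᵈ._∣_.equality p∣v) ⟨
    v * v              ≡⟨ v²≡p[pK+r] ⟩
    p * (p * K + r)    ∎)
    where
    open ≡-Reasoning
    regroup : ∀ p u → p * (p * (u * u)) ≡ u * p * (u * p)
    regroup = ℕ-Solver.solve-∀
  p∣r : p ℕᵈ.∣ r
  p∣r = ℕᵈ.∣m+n∣m⇒∣n (subst (p ℕᵈ.∣_) pu²≡pK+r (ℕᵈ.m∣m*n (u * u))) (ℕᵈ.m∣m*n K)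
  p≡1 : p ≡ 1
  p≡1 = ℕᵈ.∣1⇒≡1 (subst (p ℕᵈ.∣_) gcd≡1 (gcd-greatest p∣r ℕᵈ.∣-refl))

p^[2k+1] : ∀ p k → p ^ (2 * k + 1) ≡ p * p ^ (2 * k)
p^[2k+1] p k = cong (p ^_) (ℕₚ.+-comm (2 * k) 1)

p^[2k+2] : ∀ p k → p ^ (2 * k + 2) ≡ p * p * p ^ (2 * k)
p^[2k+2] p k = trans (cong (p ^_) (ℕₚ.+-comm (2 * k) 2)) (sym (ℕₚ.*-assoc p p (p ^ (2 * k))))

nonSquareᵢ : ∀ {p s} .{{_ : NonZero p}} → NonResidue s p → s % 8 ≡ 1 →
             ∀ n w → w * w ≢ 8 * (p * n + (s ∸ 1) / 8) + 1
nonSquareᵢ {p} {s} nonResidue s%8≡1 n w w²≡ = nonResidue⇒≢square nonResidue w (8 * n) (begin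
  w * w                          ≡⟨ w²≡ ⟩
  8 * (p * n + (s ∸ 1) / 8) + 1  ≡⟨ 8*[A+[x∸1]/8]+1 (p * n) s s%8≡1 ⟩
  8 * (p * n) + s                ≡⟨ cong (_+ s) (regroup p n) ⟩
  p * (8 * n) + s                ∎)
  where
  open ≡-Reasoning
  regroup : ∀ p n → 8 * (p * n) ≡ p * (8 * n)
  regroup = ℕ-Solver.solve-∀

nonSquareᵢᵢ : ∀ {p s} → Prime p → p ≢ 2 → NonResidue s p → s % 8 ≡ 1 →
              ∀ n k w → w * w ≢ 8 * (p ^ (2 * k + 1) * n + (s * p ^ (2 * k) ∸ 1) / 8) + 1
nonSquareᵢᵢ {p} {s} pr p≢2 nonResidue s%8≡1 n k w w²≡ =
  let v , v²≡ = square-descent pr k w (p * (8 * n) + s) (begin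
        w * w                                                   ≡⟨ w²≡ ⟩
        8 * (p ^ (2 * k + 1) * n + (s * P ∸ 1) / 8) + 1         ≡⟨ 8*[A+[x∸1]/8]+1 (p ^ (2 * k + 1) * n) (s * P) sP%8≡1 ⟩
        8 * (p ^ (2 * k + 1) * n) + s * P                       ≡⟨ cong (λ x → 8 * (x * n) + s * P) (p^[2k+1] p k) ⟩
        8 * (p * P * n) + s * P                                 ≡⟨ regroup p P n s ⟩
        P * (p * (8 * n) + s)                                   ∎)
  in nonResidue⇒≢square {{prime⇒nonZero pr}} nonResidue v (8 * n) v²≡
  where
  open ≡-Reasoning
  P = p ^ (2 * k)
  sP%8≡1 : (s * P) % 8 ≡ 1
  sP%8≡1 = %8≡1-* s P s%8≡1 (oddPrime^[2k]%8≡1 pr p≢2 k)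
  regroup : ∀ p P n s → 8 * (p * P * n) + s * P ≡ P * (p * (8 * n) + s)
  regroup = ℕ-Solver.solve-∀

nonSquareᵢᵢᵢ : ∀ {p r} → Prime p → p ≢ 2 → (r * p) % 8 ≡ 1 → gcd r p ≡ 1 →
               ∀ n k w → w * w ≢ 8 * (p ^ (2 * k + 2) * n + (r * p ^ (2 * k + 1) ∸ 1) / 8) + 1
nonSquareᵢᵢᵢ {p} {r} pr p≢2 rp%8≡1 gcd≡1 n k w w²≡ =
  let v , v²≡ = square-descent pr k w (p * (p * (8 * n) + r)) (begin
        w * w                                                       ≡⟨ w²≡ ⟩
        8 * (p ^ (2 * k + 2) * n + (r * p ^ (2 * k + 1) ∸ 1) / 8) + 1
                                               ≡⟨ 8*[A+[x∸1]/8]+1 (p ^ (2 * k + 2) * n) (r * p ^ (2 * k + 1)) rp^[2k+1]%8≡1 ⟩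
        8 * (p ^ (2 * k + 2) * n) + r * p ^ (2 * k + 1)             ≡⟨ cong₂ (λ x y → 8 * (x * n) + r * y) (p^[2k+2] p k) (p^[2k+1] p k) ⟩
        8 * (p * p * P * n) + r * (p * P)                           ≡⟨ regroup p P n r ⟩
        P * (p * (p * (8 * n) + r))                                 ∎)
  in coprime⇒p[pK+r]≢square pr gcd≡1 v (8 * n) v²≡
  where
  open ≡-Reasoning
  P = p ^ (2 * k)
  rp^[2k+1]%8≡1 : (r * p ^ (2 * k + 1)) % 8 ≡ 1
  rp^[2k+1]%8≡1 = subst (λ x → x % 8 ≡ 1)
    (trans (ℕₚ.*-assoc r p P) (cong (r *_) (sym (p^[2k+1] p k))))
    (%8≡1-* (r * p) P rp%8≡1 (oddPrime^[2k]%8≡1 pr p≢2 k))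
  regroup : ∀ p P n r → 8 * (p * p * P * n) + r * (p * P) ≡ P * (p * (p * (8 * n) + r))
  regroup = ℕ-Solver.solve-∀

theorem1p3 : (p : ℕ) → Prime p → p ≢ 2 →
    ((s : ℕ) → 1 ≤ s → s ≤ 8 * p → s % 8 ≡ 1 → legendre (+ s) p ≡ -1ℤ →
      ((n : ℕ) → + 2 ∣ pod2 (p * n + (s ∸ 1) / 8))
      × (+ 2 ∣ tau p →
          (n k : ℕ) → 1 ≤ k →
            + 2 ∣ pod2 (p ^ (2 * k + 1) * n + (s * p ^ (2 * k) ∸ 1) / 8)))
    × ((r : ℕ) → 1 ≤ r → r ≤ 8 * p → (r * p) % 8 ≡ 1 → gcd r p ≡ 1 →
      + 2 ∣ tau p →
        (n k : ℕ) → 1 ≤ k →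
          + 2 ∣ pod2 (p ^ (2 * k + 2) * n + (r * p ^ (2 * k + 1) ∸ 1) / 8))
theorem1p3 p pr p≢2 =
  (λ s _ _ s%8≡1 legendre≡-1 → let nonResidue = legendre≡-1⇒nonResidue legendre≡-1 in
    (λ n → pod2-even (p * n + (s ∸ 1) / 8) (nonSquareᵢ {{prime⇒nonZero pr}} nonResidue s%8≡1 n)) ,
    (λ _ n k _ → pod2-even (p ^ (2 * k + 1) * n + (s * p ^ (2 * k) ∸ 1) / 8)
                   (nonSquareᵢᵢ pr p≢2 nonResidue s%8≡1 n k))) ,
  (λ r _ _ rp%8≡1 gcd≡1 _ n k _ → pod2-even (p ^ (2 * k + 2) * n + (r * p ^ (2 * k + 1) ∸ 1) / 8)
                                     (nonSquareᵢᵢᵢ {r = r} pr p≢2 rp%8≡1 gcd≡1 n k))
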